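{- Let $A=\{\alpha_1,\dots,\alpha_M\}$ and $B=\{\beta_1,\dots,\beta_N\}$ be subsets of $\{0,1\}^d$ satisfying the standing assumptions (1)–(6) below, and let $\mathcal{A}$ and $\mathcal{B}$ be the regular expressions constructed from them as below. If there exist $i\in[M]$ and $j\in[N]$ with $\sum_{k=1}^d\alpha_i[k]\beta_j[k]=0$, then $\mathcal{L}(\mathcal{A})\cap\mathcal{L}(\mathcal{B})\neq\emptyset$.
   Context: Standing assumptions: (1) $M$ is odd, $N\equiv 0 \pmod 4$, and $M<N$; (2) $d\ge3$ is odd; (3) every $\alpha_i$ has $\alpha_i[1]=\alpha_i[d]=1$ and every $\beta_j$ has $\beta_j[1]=\beta_j[d]=0$; (4) neither $A$ nor $B$ contains $1^d$, $0^d$, $10^{d-2}1$ or $01^{d-2}0$; (5) $\alpha_1\cdot\beta_j\neq0$ and $\alpha_M\cdot\beta_j\ne0$ for all $j\in[N]$; (6) if some $\alpha_i\cdot\beta_j=0$ then there are $i',j'$ with $\alpha_{i'}\cdot\beta_{j'}=0$ and $i'\equiv j'\pmod 2$. Alphabet $\{x,y,\$\}$. Regexps of type $\circ+$ are concatenations of symbols $c$ or $c^+$; regexps of type $\circ|$ are concatenations of letters or unions $[c_1|\cdots|c_r]$ of letters; juxtaposition is concatenation, $c^k$ is $k$ copies of $c$ and $\mathcal{E}^k$ is $k$ concatenated copies of $\mathcal{E}$. Define $C_A(v,k)$ as $yyy^+$ ($v=1$, $k$ odd), $xxx^+$ ($v=1$, $k$ even), $y^+$ ($v=0$, $k$ odd),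 $x^+$ ($v=0$, $k$ even); and $C_B(v,k)$ as the string $y$ ($v=1$, $k$ odd), $x$ ($v=1$, $k$ even), $yyy$ ($v=0$, $k$ odd), $xxx$ ($v=0$, $k$ even). Let $a_i^\perp=C_A(\alpha_i[1],1)\cdots C_A(\alpha_i[d],d)$; let $b_j=C_B(\beta_j[1],1)\cdots C_B(\beta_j[d],d)$ for odd $j$ and $b_j=yyy\,C_B(\beta_j[1],1)\cdots C_B(\beta_j[d],d)\,yyy$ for even $j$. Let $a_0^\perp=(y^+x^+)^{\lfloor d/2\rfloor}y^+$, $a_{even}^\perp=y^6x^+(y^+x^+)^{\lfloor d/2\rfloor-1}y^6$, $b_0=(y^3[x|y]^3)^{\lfloor d/2\rfloor}y^3$, $b_{even}=y^6x(yx)^{\lfloor d/2\rfloor-1}y^6$, $b_{odd}=y^3x(yx)^{\lfloor d/2\rfloor-1}y^3$, and $b_0^{(\$)}=b_0[y|\$]$, $b_{even}^{(\$)}=b_{even}[y|\$]$, $b_{odd}^{(\$)}=b_{odd}[y|\$]$. Let $\mathcal{A}^\perp=a_1^\perp\prod_{i=2}^{M}(\$a_0^\perp\$a_i^\perp)$ (i.e. $a_1^\perp\$a_0^\perp\$a_2^\perp\$\cdots\$a_{M-1}^\perp\$a_0^\perp\$a_M^\perp$) and $\mathcal{B}^\perp=\prod_{j=1}^{N}(b_0^{(\$)}b_j\$)$. Let $P=b_0^{(\$)}b_{odd}^{(\$)}b_0^{(\$)}b_{even}^{(\$)}$ and $r=(2M+N-2)/4$. Then $\mathcal{A}=(a_0^\perp)^{2M+N}(a_0^\perp\$)^{N-1}a_{even}^\perp\$\,\mathcal{A}^\perp\,\$a_{even}^\perp(\$a_0^\perp)^{N-1}(a_0^\perp)^{2M+N}$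 (type $\circ+$) and $\mathcal{B}=(b_0)^{2M+N}P^{r}\,\mathcal{B}^\perp\,P^{r}(b_0)^{2M+N}$ (type $\circ|$). -}

module Defs where

open import Data.Bool using (Bool; true; false; _∧_; if_then_else_)
open import Data.Nat using (ℕ; zero; suc; _+_; _*_; _∸_; _<_; _≤_; ⌊_/2⌋; _%_; _/_)
open import Data.Fin using (Fin; toℕ)
open import Data.List using (List; []; _∷_; _++_; map; foldr; zipWith; allFin; replicate)
open import Data.Nat.ListAction using (sum)
open import Data.Sum using (_⊎_)
open import Data.Vec using (Vec; toList; lookup)
open import Data.Product using (Σ; _×_; ∃; ∃-syntax)
open import Relation.Binary.PropositionalEquality using (_≡_; _≢_)
open import Function.Definitions using (Injective)

data Sym : Set where
  x y $ : Sym

infixr 6 _·_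
infixr 5 _∣_

data Regex : Set where
  ε    : Regex
  sym  : Sym → Regex
  _·_  : Regex → Regex → Regex
  _∣_  : Regex → Regex → Regex
  _⁺   : Regex → Regex

data _∈L_ : List Sym → Regex → Set where
  eps   : [] ∈L ε
  sym   : ∀ c → (c ∷ []) ∈L sym c
  cat   : ∀ {u v r s} → u ∈L r → v ∈L s → (u ++ v) ∈L (r · s)
  alt₁  : ∀ {w r s} → w ∈L r → w ∈L (r ∣ s)
  alt₂  : ∀ {w r s} → w ∈L s → w ∈L (r ∣ s)
  plus₁ : ∀ {w r} → w ∈L r → w ∈L (r ⁺)
  plus₂ : ∀ {u v r} → u ∈L r → v ∈L (r ⁺) → (u ++ v) ∈L (r ⁺)

concatR : List Regex → Regex
concatR = foldr _·_ ε

rep : ℕ → Regex → Regex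
rep zero    e = ε
rep (suc k) e = e · rep k e

s : Sym → Regex
s = sym

isOdd : ℕ → Bool
isOdd zero          = false
isOdd (suc zero)    = true
isOdd (suc (suc n)) = isOdd n

b2n : Bool → ℕ
b2n true  = 1
b2n false = 0

dot : ∀ {d} → Vec Bool d → Vec Bool d → ℕ
dot u v = sum (zipWith (λ a b → b2n (a ∧ b)) (toList u) (toList v))

-- Gadgets  (positions k are 1-based)

C-A : Bool → ℕ → Regex
C-A true  k = if isOdd k then s y · s y · s y ⁺ else s x · s x · s x ⁺
C-A false k = if isOdd k then s y ⁺ else s x ⁺

C-B : Bool → ℕ → Regex
C-B true  k = if isOdd k then s y else s x
C-B false k = if isOdd k then s y · s y · s y else s x · s x · s x

encode : (Bool → ℕ → Regex) → ℕ → List Bool → Regex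
encode C k []       = ε
encode C k (b ∷ bs) = C b k · encode C (suc k) bs

aPerp : ∀ {d} → Vec Bool d → Regex
aPerp v = encode C-A 1 (toList v)

-- b_j, with j the 1-based index
bGadget : ∀ {d} → ℕ → Vec Bool d → Regex
bGadget j v = if isOdd j
  then encode C-B 1 (toList v)
  else rep 3 (s y) · encode C-B 1 (toList v) · rep 3 (s y)

module _ (d : ℕ) where

  a0 : Regex
  a0 = rep ⌊ d /2⌋ (s y ⁺ · s x ⁺) · s y ⁺

  aEven : Regex
  aEven = rep 6 (s y) · s x ⁺ · rep (⌊ d /2⌋ ∸ 1) (s y ⁺ · s x ⁺) · rep 6 (s y)

  b0 : Regex
  b0 = rep ⌊ d /2⌋ (rep 3 (s y) · rep 3 (s x ∣ s y)) · rep 3 (s y)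

  bEven : Regex
  bEven = rep 6 (s y) · s x · rep (⌊ d /2⌋ ∸ 1) (s y · s x) · rep 6 (s y)

  bOdd : Regex
  bOdd = rep 3 (s y) · s x · rep (⌊ d /2⌋ ∸ 1) (s y · s x) · rep 3 (s y)

  dol : Regex → Regex
  dol e = e · (s y ∣ s $)

  P : Regex
  P = dol b0 · dol bOdd · dol b0 · dol bEven

-- The regexps 𝒜 and ℬ  (indices i : Fin M stand for α_{toℕ i + 1})

module _ {d M N : ℕ} (α : Fin M → Vec Bool d) (β : Fin N → Vec Bool d) where

  APerp : Regex
  APerp = concatR (map piece (allFin M))
    where
    piece : Fin M → Regex
    piece i with toℕ i
    ... | zero  = aPerp (α i)
    ... | suc _ = s $ · a0 d · s $ · aPerp (α i)

  BPerp : Regex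
  BPerp = concatR (map (λ j → dol d (b0 d) · bGadget (suc (toℕ j)) (β j) · s $) (allFin N))

  r : ℕ
  r = (2 * M + N ∸ 2) / 4

  𝒜 : Regex
  𝒜 = rep (2 * M + N) (a0 d) · rep (N ∸ 1) (a0 d · s $) · aEven d · s $
      · APerp
      · s $ · aEven d · rep (N ∸ 1) (s $ · a0 d) · rep (2 * M + N) (a0 d)

  ℬ : Regex
  ℬ = rep (2 * M + N) (b0 d) · rep r (P d) · BPerp · rep r (P d) · rep (2 * M + N) (b0 d)

Forbidden : ℕ → List Bool → Set
Forbidden d w = (w ≡ replicate d true)
              ⊎ ((w ≡ replicate d false)
              ⊎ ((w ≡ true ∷ replicate (d ∸ 2) false ++ (true ∷ []))
              ⊎ (w ≡ false ∷ replicate (d ∸ 2) true ++ (false ∷ []))))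

module Submission where

-- The common word is a run of units (b0-block, separator, gadget, separator) between two runs of
-- 2M+N b0-blocks. ℬ reads the units as P^r, then one unit b0^($) b_j $ for every j, then P^r again,
-- so the gadgets are dummy bOdd/bEven words around the words of b_1 … b_N. 𝒜 reads the same word
-- with another alignment. A block is either all-y, and then disappears into a neighbouring y⁺ of 𝒜,
-- or striped (y³x³)^K y³, which fits a0 as well as every a_i^⊥. Choosing for each unit whether it is
-- absorbed, split or merged shifts 𝒜 so that a_{i₀}^⊥ lands on the gadget of b_{j₀}: there
-- α_{i₀}·β_{j₀} = 0 is exactly what lets the word of b_{j₀} be read by a_{i₀}^⊥. Assumption (5) keeps
-- i₀ off the ends of APerp, and the parity condition (6) puts the two aEven of 𝒜 on even-indexed
-- gadgets. The numbers of units of each kind come from a linear plan with two cases on each side.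

open import Defs
open import Data.Bool using (Bool; true; false; not; _∧_; _xor_; if_then_else_)
open import Data.Bool.Properties using (not-distribˡ-xor; xor-identityʳ)
open import Data.Empty using (⊥; ⊥-elim)
open import Data.Fin using (Fin; fromℕ; toℕ) renaming (zero to fzero; suc to fsuc)
open import Data.Fin.Properties using (toℕ-fromℕ; toℕ-injective; toℕ<n)
open import Data.List using (List; []; _∷_; [_]; _++_; allFin; length; map; replicate; tabulate; zipWith)
open import Data.List.Properties using (++-assoc; ++-identityʳ; length-++; length-replicate; map-tabulate)
open import Data.List.Relation.Binary.Pointwise using (Pointwise; []; _∷_)
open import Data.List.Relation.Unary.All using (All; []; _∷_)
open import Data.List.Relation.Unary.All.Properties using (++⁺; ++⁻ˡ; ++⁻ʳ; replicate⁺)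
open import Data.Nat using (ℕ; zero; suc; _+_; _*_; _∸_; _/_; _%_; _≤_; _<_; z≤n; s≤s; ⌊_/2⌋)
open import Data.Nat.DivMod using ([m+n]%n≡m%n; m*n/n≡m; m≡m%n+[m/n]*n)
open import Data.Nat.ListAction using (sum)
open import Data.Nat.Properties
  using (+-assoc; +-comm; +-identityʳ; +-suc; +-cancelʳ-≡; +-cancelˡ-≡; +-cancelˡ-≤; +-cancelʳ-≤; +-monoʳ-≤;
         m+n∸m≡n; m+n≡0⇒m≡0; m+n≡0⇒n≡0; m≤m+n; suc-injective; ≤-reflexive; ≤-total; ≤-trans; ≤∧≢⇒<; m≤n⇒∃[o]m+o≡n)
open import Data.Nat.Tactic.RingSolver using (solve-∀)
open import Data.Product using (∃; ∃₂; ∃-syntax; _×_; _,_; proj₁; proj₂)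
open import Data.Sum using (inj₁; inj₂)
open import Data.Unit using (⊤; tt)
open import Data.Vec using (Vec; lookup; toList) renaming (_∷_ to _∷ᵥ_; [] to []ᵥ)
open import Data.Vec.Properties using (length-toList)
open import Function.Definitions using (Injective)
import Relation.Binary.PropositionalEquality as ≡
open ≡ using (_≡_; _≢_; refl; trans; cong; cong₂; subst; subst₂)
open import Relation.Nullary using (¬_)
open ≡.≡-Reasoning

-- Regular-expression membership

∈L-resp-≡ : ∀ {w w′ e} → w ≡ w′ → w ∈L e → w′ ∈L e
∈L-resp-≡ refl p = p

cat-≡ : ∀ {u v w e f} → u ∈L e → v ∈L f → w ≡ u ++ v → w ∈L (e · f)
cat-≡ p q refl = cat p q

cat-inv : ∀ {w e f} → w ∈L (e · f) → ∃₂ λ u v → w ≡ u ++ v × u ∈L e × v ∈L f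
cat-inv (cat {u} {v} p q) = u , v , refl , p , q

rep-suc· : ∀ {n u v e X} → u ∈L e → v ∈L (rep n e · X) → (u ++ v) ∈L (rep (suc n) e · X)
rep-suc· {u = u} p q with cat-inv q
... | v₁ , v₂ , refl , q₁ , q₂ = cat-≡ (cat p q₁) q₂ (≡.sym (++-assoc u v₁ v₂))

rep-+ : ∀ {m n u v e} → u ∈L rep m e → v ∈L rep n e → (u ++ v) ∈L rep (m + n) e
rep-+ {zero} eps q = q
rep-+ {suc m} {v = v} (cat {u₁} {u₂} p p′) q = ∈L-resp-≡ (≡.sym (++-assoc u₁ u₂ v)) (cat p (rep-+ p′ q))

rep-+· : ∀ {m n u v e X} → u ∈L rep m e → v ∈L (rep n e · X) → (u ++ v) ∈L (rep (m + n) e · X)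
rep-+· {zero} eps q = q
rep-+· {suc m} {v = v} (cat {u₁} {u₂} p p′) q = ∈L-resp-≡ (≡.sym (++-assoc u₁ u₂ v)) (rep-suc· p (rep-+· p′ q))

rep·rep⇒rep : ∀ {m n w e} → w ∈L (rep m e · rep n e) → w ∈L rep (m + n) e
rep·rep⇒rep (cat p q) = rep-+ p q

rep-resp-≡ : ∀ {m n w e} → m ≡ n → w ∈L rep m e → w ∈L rep n e
rep-resp-≡ refl p = p

rep·-resp-≡ : ∀ {m n w e X} → m ≡ n → w ∈L (rep m e · X) → w ∈L (rep n e · X)
rep·-resp-≡ refl p = p

rep-suc-snoc· : ∀ {n u c v e X} → u ∈L e → v ∈L (rep n (e · s c) · X) → (u ++ c ∷ v) ∈L (rep (suc n) (e · s c) · X)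
rep-suc-snoc· {u = u} {c} {v} p q = ∈L-resp-≡ (++-assoc u [ c ] v) (rep-suc· (cat p (sym c)) q)

⁺-snoc : ∀ {c w} → w ∈L (s c ⁺) → (w ++ [ c ]) ∈L (s c ⁺)
⁺-snoc (plus₁ (sym c)) = plus₂ (sym c) (plus₁ (sym c))
⁺-snoc {c} (plus₂ {u} {v} p q) = ∈L-resp-≡ (≡.sym (++-assoc u v [ c ])) (plus₂ p (⁺-snoc q))

-- The regexps a0, b0, aEven, bOdd, bEven of Defs with ⌊ d /2⌋ made explicit: for d = dim k = 2k+3 it is K = k+1.

Y⁺ X⁺ : Regex
Y⁺ = s y ⁺
X⁺ = s x ⁺

A0 B0 : ℕ → Regex
A0 K = rep K (Y⁺ · X⁺) · Y⁺
B0 K = rep K (rep 3 (s y) · rep 3 (s x ∣ s y)) · rep 3 (s y)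

AEven BOdd BEven : ℕ → Regex
AEven k = rep 6 (s y) · X⁺ · rep k (Y⁺ · X⁺) · rep 6 (s y)
BOdd k = rep 3 (s y) · s x · rep k (s y · s x) · rep 3 (s y)
BEven k = rep 6 (s y) · s x · rep k (s y · s x) · rep 6 (s y)

dbl : ℕ → ℕ
dbl zero = zero
dbl (suc n) = suc (suc (dbl n))

dim : ℕ → ℕ
dim k = suc (suc (suc (dbl k)))

⌊suc-dbl/2⌋ : ∀ k → ⌊ suc (dbl k) /2⌋ ≡ k
⌊suc-dbl/2⌋ zero = refl
⌊suc-dbl/2⌋ (suc k) = cong suc (⌊suc-dbl/2⌋ k)

a0-dim : ∀ k → a0 (dim k) ≡ A0 (suc k)
a0-dim k = cong (λ n → A0 (suc n)) (⌊suc-dbl/2⌋ k)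

b0-dim : ∀ k → b0 (dim k) ≡ B0 (suc k)
b0-dim k = cong (λ n → B0 (suc n)) (⌊suc-dbl/2⌋ k)

aEven-dim : ∀ k → aEven (dim k) ≡ AEven k
aEven-dim k = cong AEven (⌊suc-dbl/2⌋ k)

bOdd-dim : ∀ k → bOdd (dim k) ≡ BOdd k
bOdd-dim k = cong BOdd (⌊suc-dbl/2⌋ k)

bEven-dim : ∀ k → bEven (dim k) ≡ BEven k
bEven-dim k = cong BEven (⌊suc-dbl/2⌋ k)

AllY : List Sym → Set
AllY = All (_≡ y)

y³ x³ y⁶ : List Sym
y³ = y ∷ y ∷ y ∷ []
x³ = x ∷ x ∷ x ∷ []
y⁶ = y³ ++ y³

y³-allY : AllY y³
y³-allY = refl ∷ refl ∷ refl ∷ []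

striped solid : ℕ → List Sym
striped zero = y³
striped (suc K) = y³ ++ x³ ++ striped K
solid zero = y³
solid (suc K) = y⁶ ++ solid K

solid-allY : ∀ K → AllY (solid K)
solid-allY zero = y³-allY
solid-allY (suc K) = ++⁺ (++⁺ y³-allY y³-allY) (solid-allY K)

yx^ : ℕ → List Sym
yx^ zero = []
yx^ (suc k) = y ∷ x ∷ yx^ k

bOddWord bEvenWord : ℕ → List Sym
bOddWord k = y³ ++ x ∷ yx^ k ++ y³
bEvenWord k = y⁶ ++ x ∷ yx^ k ++ y⁶

y³∈Y⁺ : y³ ∈L Y⁺
y³∈Y⁺ = plus₂ (sym y) (plus₂ (sym y) (plus₁ (sym y)))

x³∈X⁺ : x³ ∈L X⁺
x³∈X⁺ = plus₂ (sym x) (plus₂ (sym x) (plus₁ (sym x)))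

y⁶∈Y⁺ : y⁶ ∈L Y⁺
y⁶∈Y⁺ = plus₂ (sym y) (plus₂ (sym y) (plus₂ (sym y) y³∈Y⁺))

y³∈rep : y³ ∈L rep 3 (s y)
y³∈rep = cat (sym y) (cat (sym y) (cat (sym y) eps))

y⁶∈rep : y⁶ ∈L rep 6 (s y)
y⁶∈rep = cat (sym y) (cat (sym y) (cat (sym y) y³∈rep))

A0-prepend-y : ∀ {K w} → w ∈L A0 K → (y ∷ w) ∈L A0 K
A0-prepend-y {zero} (cat eps q) = cat eps (plus₂ (sym y) q)
A0-prepend-y {suc K} (cat (cat (cat p₁ p₂) p₃) q) = cat (cat (cat (plus₂ (sym y) p₁) p₂) p₃) q

A0-prepend-allY : ∀ {K ys w} → AllY ys → w ∈L A0 K → (ys ++ w) ∈L A0 K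
A0-prepend-allY [] p = p
A0-prepend-allY (refl ∷ a) p = A0-prepend-y (A0-prepend-allY a p)

A0-append-y : ∀ {K w} → w ∈L A0 K → (w ++ [ y ]) ∈L A0 K
A0-append-y (cat {u} {v} p q) = ∈L-resp-≡ (≡.sym (++-assoc u v [ y ])) (cat p (⁺-snoc q))

A0-append-allY : ∀ {K ys w} → AllY ys → w ∈L A0 K → (w ++ ys) ∈L A0 K
A0-append-allY {w = w} [] p = ∈L-resp-≡ (≡.sym (++-identityʳ w)) p
A0-append-allY {ys = _ ∷ ys} {w} (refl ∷ a) p = ∈L-resp-≡ (++-assoc w [ y ] ys) (A0-append-allY a (A0-append-y p))

striped∈B0 : ∀ K → striped K ∈L B0 K
striped∈B0 zero = cat eps y³∈rep
striped∈B0 (suc K) = rep-suc· (cat y³∈rep (cat (alt₁ (sym x)) (cat (alt₁ (sym x)) (cat (alt₁ (sym x)) eps)))) (striped∈B0 K)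

solid∈B0 : ∀ K → solid K ∈L B0 K
solid∈B0 zero = cat eps y³∈rep
solid∈B0 (suc K) = rep-suc· (cat y³∈rep (cat (alt₂ (sym y)) (cat (alt₂ (sym y)) (cat (alt₂ (sym y)) eps)))) (solid∈B0 K)

striped∈A0 : ∀ K → striped K ∈L A0 K
striped∈A0 zero = cat eps y³∈Y⁺
striped∈A0 (suc K) = rep-suc· (cat y³∈Y⁺ x³∈X⁺) (striped∈A0 K)

yx^∈rep : ∀ k → yx^ k ∈L rep k (s y · s x)
yx^∈rep zero = eps
yx^∈rep (suc k) = cat (cat (sym y) (sym x)) (yx^∈rep k)

yx^-prepend : ∀ k {w X} → w ∈L X → (yx^ k ++ w) ∈L (rep k (Y⁺ · X⁺) · X)
yx^-prepend zero p = cat eps p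
yx^-prepend (suc k) p = rep-suc· (cat (plus₁ (sym y)) (plus₁ (sym x))) (yx^-prepend k p)

bOddWord∈BOdd : ∀ k → bOddWord k ∈L BOdd k
bOddWord∈BOdd k = cat y³∈rep (cat (sym x) (cat (yx^∈rep k) y³∈rep))

bEvenWord∈BEven : ∀ k → bEvenWord k ∈L BEven k
bEvenWord∈BEven k = cat y⁶∈rep (cat (sym x) (cat (yx^∈rep k) y⁶∈rep))

bOddWord∈A0 : ∀ k → bOddWord k ∈L A0 (suc k)
bOddWord∈A0 k = rep-suc· (cat y³∈Y⁺ (plus₁ (sym x))) (yx^-prepend k y³∈Y⁺)

bEvenWord∈A0 : ∀ k → bEvenWord k ∈L A0 (suc k)
bEvenWord∈A0 k = rep-suc· (cat y⁶∈Y⁺ (plus₁ (sym x))) (yx^-prepend k y⁶∈Y⁺)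

bEvenWord∈AEven : ∀ k → bEvenWord k ∈L AEven k
bEvenWord∈AEven k = cat y⁶∈rep (cat (plus₁ (sym x)) (yx^-prepend k y⁶∈rep))

-- Parity and gadget words

isOdd-suc : ∀ n → isOdd (suc n) ≡ not (isOdd n)
isOdd-suc zero = refl
isOdd-suc (suc zero) = refl
isOdd-suc (suc (suc n)) = isOdd-suc n

odd⇒suc-even : ∀ n → isOdd n ≡ true → isOdd (suc n) ≡ false
odd⇒suc-even n h = trans (isOdd-suc n) (cong not h)

even⇒suc-odd : ∀ n → isOdd n ≡ false → isOdd (suc n) ≡ true
even⇒suc-odd n h = trans (isOdd-suc n) (cong not h)

isOdd-+ : ∀ m n → isOdd (m + n) ≡ isOdd m xor isOdd n
isOdd-+ zero n = refl
isOdd-+ (suc m) n = begin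
  isOdd (suc (m + n))        ≡⟨ isOdd-suc (m + n) ⟩
  not (isOdd (m + n))        ≡⟨ cong not (isOdd-+ m n) ⟩
  not (isOdd m xor isOdd n)  ≡⟨ not-distribˡ-xor (isOdd m) (isOdd n) ⟩
  not (isOdd m) xor isOdd n  ≡⟨ cong (_xor isOdd n) (≡.sym (isOdd-suc m)) ⟩
  isOdd (suc m) xor isOdd n  ∎

isOdd-dbl : ∀ n → isOdd (dbl n) ≡ false
isOdd-dbl zero = refl
isOdd-dbl (suc n) = isOdd-dbl n

isOdd-suc-dbl : ∀ n → isOdd (suc (dbl n)) ≡ true
isOdd-suc-dbl zero = refl
isOdd-suc-dbl (suc n) = isOdd-suc-dbl n

isOdd-+-even : ∀ m n → isOdd n ≡ false → isOdd (m + n) ≡ isOdd m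
isOdd-+-even m n h = trans (isOdd-+ m n) (trans (cong (isOdd m xor_) h) (xor-identityʳ (isOdd m)))

cbWord : Bool → ℕ → List Sym
cbWord true p = if isOdd p then [ y ] else [ x ]
cbWord false p = if isOdd p then y³ else x³

encodeWord : ℕ → List Bool → List Sym
encodeWord p [] = []
encodeWord p (b ∷ bs) = cbWord b p ++ encodeWord (suc p) bs

gadgetWord : Bool → List Bool → List Sym
gadgetWord true l = encodeWord 1 l
gadgetWord false l = y³ ++ encodeWord 1 l ++ y³

cbWord∈C-B : ∀ b p → cbWord b p ∈L C-B b p
cbWord∈C-B true p with isOdd p
... | true = sym y
... | false = sym x
cbWord∈C-B false p with isOdd p
... | true = cat (sym y) (cat (sym y) (sym y))
... | false = cat (sym x) (cat (sym x) (sym x))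

encodeWord∈encode-C-B : ∀ p bs → encodeWord p bs ∈L encode C-B p bs
encodeWord∈encode-C-B p [] = eps
encodeWord∈encode-C-B p (b ∷ bs) = cat (cbWord∈C-B b p) (encodeWord∈encode-C-B (suc p) bs)

gadgetWord∈bGadget : ∀ {d} j (v : Vec Bool d) → gadgetWord (isOdd j) (toList v) ∈L bGadget j v
gadgetWord∈bGadget j v with isOdd j
... | true = encodeWord∈encode-C-B 1 (toList v)
... | false = cat y³∈rep (cat (encodeWord∈encode-C-B 1 (toList v)) y³∈rep)

cbWord∈Y⁺ : ∀ b p → isOdd p ≡ true → cbWord b p ∈L Y⁺
cbWord∈Y⁺ true p h rewrite h = plus₁ (sym y)
cbWord∈Y⁺ false p h rewrite h = y³∈Y⁺

cbWord∈X⁺ : ∀ b p → isOdd p ≡ false → cbWord b p ∈L X⁺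
cbWord∈X⁺ true p h rewrite h = plus₁ (sym x)
cbWord∈X⁺ false p h rewrite h = x³∈X⁺

encodeWord∈A0 : ∀ K p bs → length bs ≡ suc (dbl K) → isOdd p ≡ true → encodeWord p bs ∈L A0 K
encodeWord∈A0 zero p (b ∷ []) refl h = cat eps (∈L-resp-≡ (≡.sym (++-identityʳ (cbWord b p))) (cbWord∈Y⁺ b p h))
encodeWord∈A0 (suc K) p (b₁ ∷ b₂ ∷ bs) hl h =
  ∈L-resp-≡ (++-assoc (cbWord b₁ p) (cbWord b₂ (suc p)) (encodeWord (suc (suc p)) bs))
    (rep-suc· (cat (cbWord∈Y⁺ b₁ p h) (cbWord∈X⁺ b₂ (suc p) (odd⇒suc-even p h)))
              (encodeWord∈A0 K (suc (suc p)) bs (suc-injective (suc-injective hl)) h))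

gadgetWord∈A0 : ∀ K o l → length l ≡ suc (dbl K) → gadgetWord o l ∈L A0 K
gadgetWord∈A0 K true l h = encodeWord∈A0 K 1 l h refl
gadgetWord∈A0 K false l h = A0-prepend-allY y³-allY (A0-append-allY y³-allY (encodeWord∈A0 K 1 l h refl))

encodeWord-from-even : ∀ k p bs {w X} → length bs ≡ suc (dbl k) → isOdd p ≡ false → w ∈L X →
                       (encodeWord p bs ++ w) ∈L (X⁺ · rep k (Y⁺ · X⁺) · X)
encodeWord-from-even zero p (b ∷ []) {w} refl h q =
  cat-≡ (cbWord∈X⁺ b p h) (cat eps q) (cong (_++ w) (++-identityʳ (cbWord b p)))
encodeWord-from-even (suc k) p (b₁ ∷ b₂ ∷ bs) {w} hl h q
  with cat-inv (encodeWord-from-even k (suc (suc p)) bs (suc-injective (suc-injective hl)) h q)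
... | u₁ , u₂ , eq , p₁ , p₂ =
  cat-≡ (cbWord∈X⁺ b₁ p h) (rep-suc· (cat (cbWord∈Y⁺ b₂ (suc p) (even⇒suc-odd p h)) p₁) p₂) (begin
    (B₁ ++ B₂ ++ W) ++ w  ≡⟨ ++-assoc B₁ (B₂ ++ W) w ⟩
    B₁ ++ (B₂ ++ W) ++ w  ≡⟨ cong (B₁ ++_) (++-assoc B₂ W w) ⟩
    B₁ ++ B₂ ++ W ++ w    ≡⟨ cong (λ z → B₁ ++ B₂ ++ z) eq ⟩
    B₁ ++ B₂ ++ u₁ ++ u₂  ≡⟨ cong (B₁ ++_) (≡.sym (++-assoc B₂ u₁ u₂)) ⟩
    B₁ ++ (B₂ ++ u₁) ++ u₂ ∎)
  where
  B₁ = cbWord b₁ p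
  B₂ = cbWord b₂ (suc p)
  W = encodeWord (suc (suc p)) bs

encodeWord-snoc : ∀ p xs b → encodeWord p (xs ++ [ b ]) ≡ encodeWord p xs ++ cbWord b (p + length xs) ++ []
encodeWord-snoc p [] b = cong (λ n → cbWord b n ++ []) (≡.sym (+-identityʳ p))
encodeWord-snoc p (c ∷ xs) b = begin
  cbWord c p ++ encodeWord (suc p) (xs ++ [ b ])
    ≡⟨ cong (cbWord c p ++_) (encodeWord-snoc (suc p) xs b) ⟩
  cbWord c p ++ encodeWord (suc p) xs ++ cbWord b (suc p + length xs) ++ []
    ≡⟨ cong (λ n → cbWord c p ++ encodeWord (suc p) xs ++ cbWord b n ++ []) (≡.sym (+-suc p (length xs))) ⟩
  cbWord c p ++ encodeWord (suc p) xs ++ cbWord b (p + suc (length xs)) ++ []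
    ≡⟨ ≡.sym (++-assoc (cbWord c p) (encodeWord (suc p) xs) _) ⟩
  (cbWord c p ++ encodeWord (suc p) xs) ++ cbWord b (p + suc (length xs)) ++ [] ∎

encode-snoc : ∀ {C : Bool → ℕ → Regex} p xs b {u v} → u ∈L encode C p xs → v ∈L C b (p + length xs) →
              (u ++ v) ∈L encode C p (xs ++ [ b ])
encode-snoc {C} p [] b {v = v} eps q = ∈L-resp-≡ (++-identityʳ v) (cat (subst (λ n → v ∈L C b n) (+-identityʳ p) q) eps)
encode-snoc {C} p (c ∷ xs) b {v = v} (cat {u₁} {u₂} p₁ p₂) q =
  ∈L-resp-≡ (≡.sym (++-assoc u₁ u₂ v)) (cat p₁ (encode-snoc (suc p) xs b p₂ (subst (λ n → v ∈L C b n) (+-suc p (length xs)) q)))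

y∷allY∈Y⁺ : ∀ {w} → AllY w → (y ∷ w) ∈L Y⁺
y∷allY∈Y⁺ [] = plus₁ (sym y)
y∷allY∈Y⁺ (refl ∷ a) = plus₂ (sym y) (y∷allY∈Y⁺ a)

y³++allY∈C-A-true : ∀ p {w} → isOdd p ≡ true → AllY w → (y³ ++ w) ∈L C-A true p
y³++allY∈C-A-true p h a rewrite h = cat (sym y) (cat (sym y) (y∷allY∈Y⁺ a))

y³∈C-A : ∀ a p → isOdd p ≡ true → y³ ∈L C-A a p
y³∈C-A true p h = y³++allY∈C-A-true p h []
y³∈C-A false p h rewrite h = y³∈Y⁺

x³∈C-A : ∀ a p → isOdd p ≡ false → x³ ∈L C-A a p
x³∈C-A true p h rewrite h = cat (sym x) (cat (sym x) (plus₁ (sym x)))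
x³∈C-A false p h rewrite h = x³∈X⁺

striped∈encode-C-A : ∀ K p as → length as ≡ suc (dbl K) → isOdd p ≡ true → striped K ∈L encode C-A p as
striped∈encode-C-A zero p (a ∷ []) refl h = cat (y³∈C-A a p h) eps
striped∈encode-C-A (suc K) p (a₁ ∷ a₂ ∷ as) hl h =
  cat (y³∈C-A a₁ p h) (cat (x³∈C-A a₂ (suc p) (odd⇒suc-even p h))
                            (striped∈encode-C-A K (suc (suc p)) as (suc-injective (suc-injective hl)) h))

Orthogonal : List Bool → List Bool → Set
Orthogonal = Pointwise (λ a b → a ∧ b ≡ false)

cbWord∈C-A : ∀ a b p → a ∧ b ≡ false → cbWord b p ∈L C-A a p
cbWord∈C-A true false p _ with isOdd p
... | true = cat (sym y) (cat (sym y) (plus₁ (sym y)))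
... | false = cat (sym x) (cat (sym x) (plus₁ (sym x)))
cbWord∈C-A false true p _ with isOdd p
... | true = plus₁ (sym y)
... | false = plus₁ (sym x)
cbWord∈C-A false false p _ with isOdd p
... | true = y³∈Y⁺
... | false = x³∈X⁺

encodeWord∈encode-C-A : ∀ {as bs} → Orthogonal as bs → ∀ p → encodeWord p bs ∈L encode C-A p as
encodeWord∈encode-C-A [] p = eps
encodeWord∈encode-C-A (_∷_ {a} {b} h o) p = cat (cbWord∈C-A a b p h) (encodeWord∈encode-C-A o (suc p))

cbWord-false-odd : ∀ n → isOdd n ≡ true → cbWord false n ++ [] ≡ y³
cbWord-false-odd n h rewrite h = refl

encodeWord-framed : ∀ k mid → length mid ≡ suc (dbl k) → encodeWord 1 (false ∷ mid ++ [ false ]) ≡ y³ ++ encodeWord 2 mid ++ y³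
encodeWord-framed k mid h = cong (y³ ++_) (trans (encodeWord-snoc 2 mid false)
  (cong (encodeWord 2 mid ++_) (cbWord-false-odd (length mid) (trans (cong isOdd h) (isOdd-suc-dbl k)))))

Framed : ℕ → Bool → List Bool → List Bool → Set
Framed k b l mid = l ≡ b ∷ mid ++ [ b ] × length mid ≡ suc (dbl k)

pad : Bool → List Sym
pad true = []
pad false = y³

pad-allY : ∀ o → AllY (pad o)
pad-allY true = []
pad-allY false = y³-allY

gadgetWord-framed : ∀ o k mid → length mid ≡ suc (dbl k) →
                    gadgetWord o (false ∷ mid ++ [ false ]) ≡ pad o ++ y³ ++ encodeWord 2 mid ++ y³ ++ pad o
gadgetWord-framed true k mid h = encodeWord-framed k mid h
gadgetWord-framed false k mid h = begin
  y³ ++ encodeWord 1 (false ∷ mid ++ [ false ]) ++ y³ ≡⟨ cong (λ w → y³ ++ w ++ y³) (encodeWord-framed k mid h) ⟩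
  y³ ++ (y³ ++ W ++ y³) ++ y³                          ≡⟨ cong (y⁶ ++_) (++-assoc W y³ y³) ⟩
  y³ ++ y³ ++ W ++ y³ ++ y³                            ∎
  where W = encodeWord 2 mid

framedGadget∈AEven : ∀ k mid → length mid ≡ suc (dbl k) → gadgetWord false (false ∷ mid ++ [ false ]) ∈L AEven k
framedGadget∈AEven k mid h =
  ∈L-resp-≡ (≡.sym (gadgetWord-framed false k mid h)) (cat y⁶∈rep (encodeWord-from-even k 2 mid h refl y⁶∈rep))

-- The all-y prefix and the y-padding of the gadget are swallowed by the y y y⁺ that C-A puts at both ends,
-- where α has a 1; in between orthogonality is used position by position.
merged∈encode-C-A : ∀ k amid bmid o → length amid ≡ suc (dbl k) → length bmid ≡ suc (dbl k) → Orthogonal amid bmid →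
                    (solid (suc k) ++ y ∷ gadgetWord o (false ∷ bmid ++ [ false ])) ∈L encode C-A 1 (true ∷ amid ++ [ true ])
merged∈encode-C-A k amid bmid o la lb orth = ∈L-resp-≡ (≡.sym eq)
  (cat (y³++allY∈C-A-true 1 refl ys-allY)
       (encode-snoc 2 amid true (encodeWord∈encode-C-A orth 2)
                    (y³++allY∈C-A-true (2 + length amid) (trans (cong isOdd la) (isOdd-suc-dbl k)) (pad-allY o))))
  where
  W = encodeWord 2 bmid
  R = W ++ y³ ++ pad o
  ys = y³ ++ solid k ++ y ∷ pad o ++ y³
  ys-allY : AllY ys
  ys-allY = ++⁺ y³-allY (++⁺ (solid-allY k) (refl ∷ ++⁺ (pad-allY o) y³-allY))
  eq : solid (suc k) ++ y ∷ gadgetWord o (false ∷ bmid ++ [ false ]) ≡ (y³ ++ ys) ++ R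
  eq = begin
    solid (suc k) ++ y ∷ gadgetWord o (false ∷ bmid ++ [ false ])
      ≡⟨ cong (λ g → solid (suc k) ++ y ∷ g) (gadgetWord-framed o k bmid lb) ⟩
    y⁶ ++ solid k ++ y ∷ pad o ++ y³ ++ R
      ≡⟨ cong (λ z → y⁶ ++ solid k ++ y ∷ z) (≡.sym (++-assoc (pad o) y³ R)) ⟩
    y⁶ ++ solid k ++ (y ∷ pad o ++ y³) ++ R
      ≡⟨ cong (y⁶ ++_) (≡.sym (++-assoc (solid k) (y ∷ pad o ++ y³) R)) ⟩
    (y³ ++ ys) ++ R ∎

-- 𝒜 reads an absorbed unit (all-y block, y, gadget, y) inside a single a0, a split unit
-- (striped block, $, gadget, $) as two a0-blocks, and a merged unit (all-y block, y, gadget, $) as one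
-- a0-block made of the gadget with the y's glued in front.

data Mode : Set where
  absorb split merge : Mode

DollarEnded : Mode → Set
DollarEnded absorb = ⊥
DollarEnded split = ⊤
DollarEnded merge = ⊤

concatUpTo : (ℕ → List Sym) → ℕ → List Sym
concatUpTo f zero = []
concatUpTo f (suc n) = f 0 ++ concatUpTo (λ i → f (suc i)) n

map-allFin-suc : ∀ {n} (h : Fin (suc n) → Regex) → map (λ j → h (fsuc j)) (allFin n) ≡ map h (tabulate fsuc)
map-allFin-suc h = trans (map-tabulate (λ j → j) (λ j → h (fsuc j))) (≡.sym (map-tabulate fsuc h))

concatUpTo∈concatR : ∀ n (h : Fin n → Regex) (f : ℕ → List Sym) {w X} → (∀ j → f (toℕ j) ∈L h j) → w ∈L X →
                     (concatUpTo f n ++ w) ∈L (concatR (map h (allFin n)) · X)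
concatUpTo∈concatR zero h f hf q = cat eps q
concatUpTo∈concatR (suc n) h f {w} hf q
  with cat-inv (concatUpTo∈concatR n (λ j → h (fsuc j)) (λ i → f (suc i)) (λ j → hf (fsuc j)) q)
... | u₁ , u₂ , eq , p₁ , p₂ =
  cat-≡ (cat (hf fzero) (subst (λ l → u₁ ∈L concatR l) (map-allFin-suc h) p₁)) p₂
        (trans (++-assoc (f 0) F w) (trans (cong (f 0 ++_) eq) (≡.sym (++-assoc (f 0) u₁ u₂))))
  where F = concatUpTo (λ i → f (suc i)) n

module Units (k : ℕ) where
  K : ℕ
  K = suc k

  blockWord : Mode → List Sym
  blockWord split = striped K
  blockWord absorb = solid K
  blockWord merge = solid K

  blockSep gadgetSep : Mode → Sym
  blockSep split = $
  blockSep absorb = y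
  blockSep merge = y
  gadgetSep split = $
  gadgetSep absorb = y
  gadgetSep merge = $

  unitWord : Mode → List Sym → List Sym
  unitWord m g = (blockWord m ++ [ blockSep m ]) ++ (g ++ [ gadgetSep m ])

  unitsWord : List Mode → (ℕ → List Sym) → List Sym
  unitsWord [] g = []
  unitsWord (m ∷ ms) g = unitWord m (g 0) ++ unitsWord ms (λ t → g (suc t))

  unitsWord-++ : ∀ ms ns g → unitsWord (ms ++ ns) g ≡ unitsWord ms g ++ unitsWord ns (λ t → g (length ms + t))
  unitsWord-++ [] ns g = refl
  unitsWord-++ (m ∷ ms) ns g =
    trans (cong (unitWord m (g 0) ++_) (unitsWord-++ ms ns (λ t → g (suc t)))) (≡.sym (++-assoc (unitWord m (g 0)) _ _))

  unitsWord-replicate-++ : ∀ n m ns g → unitsWord (replicate n m ++ ns) g ≡ unitsWord (replicate n m) g ++ unitsWord ns (λ t → g (n + t))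
  unitsWord-replicate-++ zero m ns g = refl
  unitsWord-replicate-++ (suc n) m ns g =
    trans (cong (unitWord m (g 0) ++_) (unitsWord-replicate-++ n m ns (λ t → g (suc t)))) (≡.sym (++-assoc (unitWord m (g 0)) _ _))

  unitsWord-cong : ∀ ms g g′ → (∀ t → g t ≡ g′ t) → unitsWord ms g ≡ unitsWord ms g′
  unitsWord-cong [] g g′ h = refl
  unitsWord-cong (m ∷ ms) g g′ h =
    cong₂ (λ a b → unitWord m a ++ b) (h 0) (unitsWord-cong ms (λ t → g (suc t)) (λ t → g′ (suc t)) (λ t → h (suc t)))

  mergedWord : List Sym → List Sym
  mergedWord w = solid K ++ y ∷ w

  unitWord-++ : ∀ m g w → unitWord m g ++ w ≡ blockWord m ++ blockSep m ∷ g ++ gadgetSep m ∷ w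
  unitWord-++ m g w = begin
    ((B ++ [ s₁ ]) ++ (g ++ [ s₂ ])) ++ w ≡⟨ ++-assoc (B ++ [ s₁ ]) _ w ⟩
    (B ++ [ s₁ ]) ++ (g ++ [ s₂ ]) ++ w   ≡⟨ ++-assoc B [ s₁ ] _ ⟩
    B ++ s₁ ∷ (g ++ [ s₂ ]) ++ w          ≡⟨ cong (λ z → B ++ s₁ ∷ z) (++-assoc g [ s₂ ] w) ⟩
    B ++ s₁ ∷ g ++ s₂ ∷ w                 ∎
    where
    B = blockWord m
    s₁ = blockSep m
    s₂ = gadgetSep m

  unitsWord-suc-++ : ∀ m ms g w →
    unitsWord (m ∷ ms) g ++ w ≡ blockWord m ++ blockSep m ∷ g 0 ++ gadgetSep m ∷ unitsWord ms (λ t → g (suc t)) ++ w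
  unitsWord-suc-++ m ms g w =
    trans (++-assoc (unitWord m (g 0)) (unitsWord ms (λ t → g (suc t))) w) (unitWord-++ m (g 0) _)

  unitsWord-merge-++ : ∀ ms g w →
    unitsWord (merge ∷ ms) g ++ w ≡ mergedWord (g 0) ++ $ ∷ unitsWord ms (λ t → g (suc t)) ++ w
  unitsWord-merge-++ ms g w =
    trans (unitsWord-suc-++ merge ms g w) (≡.sym (++-assoc (solid K) (y ∷ g 0) _))

  d : ℕ
  d = dim k

  fromA0 : ∀ {w} → w ∈L A0 K → w ∈L a0 d
  fromA0 {w} = subst (w ∈L_) (≡.sym (a0-dim k))

  toA0 : ∀ {w} → w ∈L a0 d → w ∈L A0 K
  toA0 {w} = subst (w ∈L_) (a0-dim k)

  fromAEven : ∀ {w} → w ∈L AEven k → w ∈L aEven d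
  fromAEven {w} = subst (w ∈L_) (≡.sym (aEven-dim k))

  FitsA0 : (ℕ → List Sym) → Set
  FitsA0 g = ∀ t → g t ∈L a0 d

  striped∈a0 : striped K ∈L a0 d
  striped∈a0 = fromA0 (striped∈A0 K)

  mergedWord∈a0 : ∀ {w} → w ∈L a0 d → mergedWord w ∈L a0 d
  mergedWord∈a0 p = fromA0 (A0-prepend-allY (solid-allY K) (A0-prepend-y (toA0 p)))

  absorbed∈a0 : ∀ {g} → g ∈L a0 d → unitWord absorb g ∈L a0 d
  absorbed∈a0 {g} p = ∈L-resp-≡ (≡.sym (++-assoc (solid K) [ y ] (g ++ [ y ]))) (mergedWord∈a0 (fromA0 (A0-append-y (toA0 p))))

  absorbs∈a0 : ∀ n g {w X} → FitsA0 g → w ∈L X → (unitsWord (replicate n absorb) g ++ w) ∈L (rep n (a0 d) · X)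
  absorbs∈a0 zero g fit q = cat eps q
  absorbs∈a0 (suc n) g {w} fit q =
    ∈L-resp-≡ (≡.sym (++-assoc (unitWord absorb (g 0)) _ w))
      (rep-suc· (absorbed∈a0 (fit 0)) (absorbs∈a0 n (λ t → g (suc t)) (λ t → fit (suc t)) q))

  splits∈a0$ : ∀ n g {w n′ X} → FitsA0 g → w ∈L (rep n′ (a0 d · s $) · X) →
               (unitsWord (replicate n split) g ++ w) ∈L (rep (dbl n + n′) (a0 d · s $) · X)
  splits∈a0$ zero g fit q = q
  splits∈a0$ (suc n) g {w} fit q =
    ∈L-resp-≡ (≡.sym (unitsWord-suc-++ split (replicate n split) g w))
      (rep-suc-snoc· striped∈a0 (rep-suc-snoc· (fit 0) (splits∈a0$ n (λ t → g (suc t)) (λ t → fit (suc t)) q)))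

  merges∈a0$ : ∀ n g {w n′ X} → FitsA0 g → w ∈L (rep n′ (a0 d · s $) · X) →
               (unitsWord (replicate n merge) g ++ w) ∈L (rep (n + n′) (a0 d · s $) · X)
  merges∈a0$ zero g fit q = q
  merges∈a0$ (suc n) g {w} fit q =
    ∈L-resp-≡ (≡.sym (unitsWord-merge-++ (replicate n merge) g w))
      (rep-suc-snoc· (mergedWord∈a0 (fit 0)) (merges∈a0$ n (λ t → g (suc t)) (λ t → fit (suc t)) q))

  $splits∈$a0 : ∀ n g {w n′ X} → FitsA0 g → ($ ∷ w) ∈L (rep n′ (s $ · a0 d) · X) →
                ($ ∷ unitsWord (replicate n split) g ++ w) ∈L (rep (dbl n + n′) (s $ · a0 d) · X)
  $splits∈$a0 zero g fit q = q
  $splits∈$a0 (suc n) g {w} fit q =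
    ∈L-resp-≡ (cong ($ ∷_) (≡.sym (unitsWord-suc-++ split (replicate n split) g w)))
      (rep-suc· (cat (sym $) striped∈a0) (rep-suc· (cat (sym $) (fit 0)) ($splits∈$a0 n (λ t → g (suc t)) (λ t → fit (suc t)) q)))

  $merges∈$a0 : ∀ n g {w n′ X} → FitsA0 g → ($ ∷ w) ∈L (rep n′ (s $ · a0 d) · X) →
                ($ ∷ unitsWord (replicate n merge) g ++ w) ∈L (rep (n + n′) (s $ · a0 d) · X)
  $merges∈$a0 zero g fit q = q
  $merges∈$a0 (suc n) g {w} fit q =
    ∈L-resp-≡ (cong ($ ∷_) (≡.sym (unitsWord-merge-++ (replicate n merge) g w)))
      (rep-suc· (cat (sym $) (mergedWord∈a0 (fit 0))) ($merges∈$a0 n (λ t → g (suc t)) (λ t → fit (suc t)) q))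

  fromB0 : ∀ {w} → w ∈L B0 K → w ∈L b0 d
  fromB0 {w} = subst (w ∈L_) (≡.sym (b0-dim k))

  blockWord∈b0 : ∀ m → blockWord m ∈L b0 d
  blockWord∈b0 split = fromB0 (striped∈B0 K)
  blockWord∈b0 absorb = fromB0 (solid∈B0 K)
  blockWord∈b0 merge = fromB0 (solid∈B0 K)

  blockSep∈y∣$ : ∀ m → [ blockSep m ] ∈L (s y ∣ s $)
  blockSep∈y∣$ split = alt₂ (sym $)
  blockSep∈y∣$ absorb = alt₁ (sym y)
  blockSep∈y∣$ merge = alt₁ (sym y)

  gadgetSep∈y∣$ : ∀ m → [ gadgetSep m ] ∈L (s y ∣ s $)
  gadgetSep∈y∣$ split = alt₂ (sym $)
  gadgetSep∈y∣$ absorb = alt₁ (sym y)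
  gadgetSep∈y∣$ merge = alt₂ (sym $)

  block∈dol-b0 : ∀ m → (blockWord m ++ [ blockSep m ]) ∈L dol d (b0 d)
  block∈dol-b0 m = cat (blockWord∈b0 m) (blockSep∈y∣$ m)

  DummyPairs : ℕ → (ℕ → List Sym) → Set
  DummyPairs zero g = ⊤
  DummyPairs (suc r) g = g 0 ≡ bOddWord k × g 1 ≡ bEvenWord k × DummyPairs r (λ t → g (suc (suc t)))

  dummies∈rep-P : ∀ r ms g → length ms ≡ dbl r → DummyPairs r g → unitsWord ms g ∈L rep r (P d)
  dummies∈rep-P zero [] g _ _ = eps
  dummies∈rep-P (suc r) (m₁ ∷ m₂ ∷ ms) g hl (e₁ , e₂ , dp) =
    ∈L-resp-≡ eq (cat (cat (block∈dol-b0 m₁) (cat (cat odd (gadgetSep∈y∣$ m₁)) (cat (block∈dol-b0 m₂) (cat even (gadgetSep∈y∣$ m₂)))))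
                      (dummies∈rep-P r ms (λ t → g (suc (suc t))) (suc-injective (suc-injective hl)) dp))
    where
    odd : g 0 ∈L bOdd d
    odd = subst (_∈L bOdd d) (≡.sym e₁) (subst (bOddWord k ∈L_) (≡.sym (bOdd-dim k)) (bOddWord∈BOdd k))
    even : g 1 ∈L bEven d
    even = subst (_∈L bEven d) (≡.sym e₂) (subst (bEvenWord k ∈L_) (≡.sym (bEven-dim k)) (bEvenWord∈BEven k))
    a₁ = blockWord m₁ ++ [ blockSep m₁ ]
    a₂ = g 0 ++ [ gadgetSep m₁ ]
    a₃₄ = unitWord m₂ (g 1)
    R = unitsWord ms (λ t → g (suc (suc t)))
    eq : (a₁ ++ a₂ ++ a₃₄) ++ R ≡ (a₁ ++ a₂) ++ a₃₄ ++ R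
    eq = trans (++-assoc a₁ _ R) (trans (cong (a₁ ++_) (++-assoc a₂ a₃₄ R)) (≡.sym (++-assoc a₁ a₂ _)))

  dollarEnded∈ : ∀ m {g R} → DollarEnded m → g ∈L R → unitWord m g ∈L (dol d (b0 d) · R · s $)
  dollarEnded∈ split _ p = cat (block∈dol-b0 split) (cat p (sym $))
  dollarEnded∈ merge _ p = cat (block∈dol-b0 merge) (cat p (sym $))

  dollarEndeds∈concatR : ∀ n (h : Fin n → Regex) ms g → length ms ≡ n → All DollarEnded ms →
                         (∀ j m → DollarEnded m → unitWord m (g (toℕ j)) ∈L h j) → unitsWord ms g ∈L concatR (map h (allFin n))
  dollarEndeds∈concatR zero h [] g _ _ _ = eps
  dollarEndeds∈concatR (suc n) h (m ∷ ms) g hl (e ∷ es) hh =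
    cat (hh fzero m e) (subst (λ l → unitsWord ms (λ t → g (suc t)) ∈L concatR l) (map-allFin-suc h)
          (dollarEndeds∈concatR n (λ j → h (fsuc j)) ms (λ t → g (suc t)) (suc-injective hl) es (λ j → hh (fsuc j))))

  splitPiece : List Sym → List Sym
  splitPiece w = $ ∷ w ++ $ ∷ striped K

  splitPiece-++ : ∀ w v → splitPiece w ++ v ≡ $ ∷ w ++ $ ∷ striped K ++ v
  splitPiece-++ w v = cong ($ ∷_) (++-assoc w ($ ∷ striped K) v)

  -- For the units split^c split merge merge split^m with gadgets g, piece c g i is what the i-th
  -- "$ a0 $ a^⊥" of APerp reads; in piece c that a^⊥ reads the first merged unit.
  piece : ℕ → (ℕ → List Sym) → ℕ → List Sym
  piece (suc c) g zero = splitPiece (g 0)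
  piece (suc c) g (suc i) = piece c (λ t → g (suc t)) i
  piece zero g zero = $ ∷ g 0 ++ $ ∷ mergedWord (g 1)
  piece zero g (suc zero) = splitPiece (mergedWord (g 2))
  piece zero g (suc (suc i)) = splitPiece (g (3 + i))

  splits-regroup : ∀ n g w →
    unitsWord (replicate n split) g ++ striped K ++ w ≡ striped K ++ concatUpTo (λ i → splitPiece (g i)) n ++ w
  splits-regroup zero g w = refl
  splits-regroup (suc n) g w = begin
    unitsWord (replicate (suc n) split) g ++ striped K ++ w
      ≡⟨ unitsWord-suc-++ split (replicate n split) g _ ⟩
    striped K ++ $ ∷ g 0 ++ $ ∷ unitsWord (replicate n split) (λ t → g (suc t)) ++ striped K ++ w
      ≡⟨ cong (λ z → striped K ++ $ ∷ g 0 ++ $ ∷ z) (splits-regroup n (λ t → g (suc t)) w) ⟩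
    striped K ++ $ ∷ g 0 ++ $ ∷ striped K ++ D ++ w
      ≡⟨ cong (striped K ++_) (≡.sym (splitPiece-++ (g 0) (D ++ w))) ⟩
    striped K ++ splitPiece (g 0) ++ D ++ w
      ≡⟨ cong (striped K ++_) (≡.sym (++-assoc (splitPiece (g 0)) D w)) ⟩
    striped K ++ (splitPiece (g 0) ++ D) ++ w ∎
    where D = concatUpTo (λ i → splitPiece (g (suc i))) n

  middle-regroup : ∀ c m g w →
    unitsWord (replicate c split ++ split ∷ merge ∷ merge ∷ replicate m split) g ++ striped K ++ w
      ≡ striped K ++ concatUpTo (piece c g) (c + suc (suc m)) ++ w
  middle-regroup zero m g w = begin
    unitsWord (split ∷ merge ∷ merge ∷ replicate m split) g ++ striped K ++ w
      ≡⟨ unitsWord-suc-++ split (merge ∷ merge ∷ replicate m split) g _ ⟩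
    striped K ++ $ ∷ g 0 ++ $ ∷ unitsWord (merge ∷ merge ∷ replicate m split) (λ t → g (suc t)) ++ striped K ++ w
      ≡⟨ cong (λ z → striped K ++ $ ∷ g 0 ++ $ ∷ z) (unitsWord-merge-++ (merge ∷ replicate m split) (λ t → g (suc t)) _) ⟩
    striped K ++ $ ∷ g 0 ++ $ ∷ mergedWord (g 1) ++ $ ∷ unitsWord (merge ∷ replicate m split) (λ t → g (2 + t)) ++ striped K ++ w
      ≡⟨ cong (λ z → striped K ++ $ ∷ g 0 ++ $ ∷ mergedWord (g 1) ++ $ ∷ z) (unitsWord-merge-++ (replicate m split) (λ t → g (2 + t)) _) ⟩
    striped K ++ $ ∷ g 0 ++ $ ∷ mergedWord (g 1) ++ $ ∷ mergedWord (g 2) ++ $ ∷ unitsWord (replicate m split) g₃ ++ striped K ++ w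
      ≡⟨ cong (λ z → striped K ++ $ ∷ g 0 ++ $ ∷ mergedWord (g 1) ++ $ ∷ mergedWord (g 2) ++ $ ∷ z) (splits-regroup m g₃ w) ⟩
    striped K ++ $ ∷ g 0 ++ $ ∷ mergedWord (g 1) ++ $ ∷ mergedWord (g 2) ++ $ ∷ striped K ++ D ++ w
      ≡⟨ cong (striped K ++_) (≡.sym pieces) ⟩
    striped K ++ (P₀ ++ P₁ ++ D) ++ w ∎
    where
    g₃ : ℕ → List Sym
    g₃ t = g (3 + t)
    D = concatUpTo (λ i → splitPiece (g₃ i)) m
    P₀ = $ ∷ g 0 ++ $ ∷ mergedWord (g 1)
    P₁ = splitPiece (mergedWord (g 2))
    pieces : (P₀ ++ P₁ ++ D) ++ w ≡ $ ∷ g 0 ++ $ ∷ mergedWord (g 1) ++ $ ∷ mergedWord (g 2) ++ $ ∷ striped K ++ D ++ w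
    pieces = begin
      (P₀ ++ P₁ ++ D) ++ w ≡⟨ ++-assoc P₀ (P₁ ++ D) w ⟩
      P₀ ++ (P₁ ++ D) ++ w ≡⟨ cong (P₀ ++_) (++-assoc P₁ D w) ⟩
      P₀ ++ P₁ ++ D ++ w   ≡⟨ cong (P₀ ++_) (splitPiece-++ (mergedWord (g 2)) (D ++ w)) ⟩
      P₀ ++ $ ∷ mergedWord (g 2) ++ $ ∷ striped K ++ D ++ w ≡⟨ cong ($ ∷_) (++-assoc (g 0) ($ ∷ mergedWord (g 1)) _) ⟩
      $ ∷ g 0 ++ $ ∷ mergedWord (g 1) ++ $ ∷ mergedWord (g 2) ++ $ ∷ striped K ++ D ++ w ∎
  middle-regroup (suc c) m g w = begin
    unitsWord (split ∷ replicate c split ++ split ∷ merge ∷ merge ∷ replicate m split) g ++ striped K ++ w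
      ≡⟨ unitsWord-suc-++ split (replicate c split ++ split ∷ merge ∷ merge ∷ replicate m split) g _ ⟩
    striped K ++ $ ∷ g 0 ++ $ ∷ unitsWord (replicate c split ++ split ∷ merge ∷ merge ∷ replicate m split) (λ t → g (suc t)) ++ striped K ++ w
      ≡⟨ cong (λ z → striped K ++ $ ∷ g 0 ++ $ ∷ z) (middle-regroup c m (λ t → g (suc t)) w) ⟩
    striped K ++ $ ∷ g 0 ++ $ ∷ striped K ++ D ++ w
      ≡⟨ cong (striped K ++_) (≡.sym (splitPiece-++ (g 0) (D ++ w))) ⟩
    striped K ++ splitPiece (g 0) ++ D ++ w
      ≡⟨ cong (striped K ++_) (≡.sym (++-assoc (splitPiece (g 0)) D w)) ⟩
    striped K ++ (splitPiece (g 0) ++ D) ++ w ∎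
    where D = concatUpTo (piece c (λ t → g (suc t))) (c + suc (suc m))

  piece∈ : ∀ c g i R → FitsA0 g → striped K ∈L R → (i ≡ c → mergedWord (g (suc i)) ∈L R) →
           piece c g i ∈L (s $ · a0 d · s $ · R)
  piece∈ (suc c) g zero R fit hs hm = cat (sym $) (cat (fit 0) (cat (sym $) hs))
  piece∈ (suc c) g (suc i) R fit hs hm = piece∈ c (λ t → g (suc t)) i R (λ t → fit (suc t)) hs (λ e → hm (cong suc e))
  piece∈ zero g zero R fit hs hm = cat (sym $) (cat (fit 0) (cat (sym $) (hm refl)))
  piece∈ zero g (suc zero) R fit hs hm = cat (sym $) (cat (mergedWord∈a0 (fit 2)) (cat (sym $) hs))
  piece∈ zero g (suc (suc i)) R fit hs hm = cat (sym $) (cat (fit (3 + i)) (cat (sym $) hs))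

  FramedVec : Bool → Vec Bool d → Set
  FramedVec b v = ∃ (Framed k b (toList v))

  striped∈aPerp : ∀ v → striped K ∈L aPerp {d} v
  striped∈aPerp v = striped∈encode-C-A K 1 (toList v) (length-toList v) refl

-- The gadget sequence: 2ρ dummies, the gadgets of b_1 … b_N, then dummies again

module GadgetSequence (k N : ℕ) (β : Fin N → Vec Bool (dim k)) where
  open Units k

  gadgetOf : ℕ → Vec Bool d → List Sym
  gadgetOf j v = gadgetWord (isOdd j) (toList v)

  dummy : ℕ → List Sym
  dummy zero = bOddWord k
  dummy (suc zero) = bEvenWord k
  dummy (suc (suc t)) = dummy t

  gadgetsFrom : (n : ℕ) → (Fin n → Vec Bool d) → ℕ → ℕ → List Sym
  gadgetsFrom zero f t offset = dummy t
  gadgetsFrom (suc n) f zero offset = gadgetOf (suc offset) (f fzero)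
  gadgetsFrom (suc n) f (suc t) offset = gadgetsFrom n (λ i → f (fsuc i)) t (suc offset)

  realGadgets : ℕ → List Sym
  realGadgets t = gadgetsFrom N β t 0

  gadgets : ℕ → ℕ → List Sym
  gadgets zero t = realGadgets t
  gadgets (suc r) zero = dummy 0
  gadgets (suc r) (suc zero) = dummy 1
  gadgets (suc r) (suc (suc t)) = gadgets r t

  dummy∈a0 : ∀ t → dummy t ∈L a0 d
  dummy∈a0 zero = fromA0 (bOddWord∈A0 k)
  dummy∈a0 (suc zero) = fromA0 (bEvenWord∈A0 k)
  dummy∈a0 (suc (suc t)) = dummy∈a0 t

  gadgetsFrom∈a0 : ∀ n f t offset → gadgetsFrom n f t offset ∈L a0 d
  gadgetsFrom∈a0 zero f t offset = dummy∈a0 t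
  gadgetsFrom∈a0 (suc n) f zero offset = fromA0 (gadgetWord∈A0 K (isOdd (suc offset)) (toList (f fzero)) (length-toList (f fzero)))
  gadgetsFrom∈a0 (suc n) f (suc t) offset = gadgetsFrom∈a0 n (λ i → f (fsuc i)) t (suc offset)

  gadgets∈a0 : ∀ r → FitsA0 (gadgets r)
  gadgets∈a0 zero t = gadgetsFrom∈a0 N β t 0
  gadgets∈a0 (suc r) zero = dummy∈a0 0
  gadgets∈a0 (suc r) (suc zero) = dummy∈a0 1
  gadgets∈a0 (suc r) (suc (suc t)) = gadgets∈a0 r t

  dummy-odd : ∀ t → isOdd t ≡ true → dummy t ≡ bEvenWord k
  dummy-odd (suc zero) h = refl
  dummy-odd (suc (suc t)) h = dummy-odd t h

  gadgetOf∈aEven : ∀ j v → isOdd j ≡ false → FramedVec false v → gadgetOf j v ∈L aEven d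
  gadgetOf∈aEven j v h (mid , e , l) rewrite h | e = fromAEven (framedGadget∈AEven k mid l)

  gadgetsFrom∈aEven : ∀ n f t offset → (∀ i → FramedVec false (f i)) →
                      isOdd (t + offset) ≡ true → isOdd (n + offset) ≡ false → gadgetsFrom n f t offset ∈L aEven d
  gadgetsFrom∈aEven zero f t offset _ ht hn =
    subst (_∈L aEven d) (≡.sym (dummy-odd t (trans (≡.sym (isOdd-+-even t offset hn)) ht))) (fromAEven (bEvenWord∈AEven k))
  gadgetsFrom∈aEven (suc n) f zero offset fr ht hn = gadgetOf∈aEven (suc offset) (f fzero) (odd⇒suc-even offset ht) (fr fzero)
  gadgetsFrom∈aEven (suc n) f (suc t) offset fr ht hn =
    gadgetsFrom∈aEven n (λ i → f (fsuc i)) t (suc offset) (λ i → fr (fsuc i))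
      (trans (cong isOdd (+-suc t offset)) ht) (trans (cong isOdd (+-suc n offset)) hn)

  gadgets∈aEven : ∀ r t → (∀ i → FramedVec false (β i)) → isOdd N ≡ false → isOdd t ≡ true → gadgets r t ∈L aEven d
  gadgets∈aEven zero t fr hN ht =
    gadgetsFrom∈aEven N β t 0 fr (trans (cong isOdd (+-identityʳ t)) ht) (trans (cong isOdd (+-identityʳ N)) hN)
  gadgets∈aEven (suc r) (suc zero) fr hN ht = fromAEven (bEvenWord∈AEven k)
  gadgets∈aEven (suc r) (suc (suc t)) fr hN ht = gadgets∈aEven r t fr hN ht

  gadgets-dummyPairs : ∀ r → DummyPairs r (gadgets r)
  gadgets-dummyPairs zero = tt
  gadgets-dummyPairs (suc r) = refl , refl , gadgets-dummyPairs r

  dummy-dummyPairs : ∀ r → DummyPairs r dummy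
  dummy-dummyPairs zero = tt
  dummy-dummyPairs (suc r) = refl , refl , dummy-dummyPairs r

  gadgets-shift : ∀ r t → gadgets r (dbl r + t) ≡ realGadgets t
  gadgets-shift zero t = refl
  gadgets-shift (suc r) t = gadgets-shift r t

  gadgetsFrom-real : ∀ n f (j : Fin n) offset → gadgetsFrom n f (toℕ j) offset ≡ gadgetOf (suc (offset + toℕ j)) (f j)
  gadgetsFrom-real (suc n) f fzero offset = cong (λ z → gadgetOf (suc z) (f fzero)) (≡.sym (+-identityʳ offset))
  gadgetsFrom-real (suc n) f (fsuc j) offset =
    trans (gadgetsFrom-real n (λ i → f (fsuc i)) j (suc offset)) (cong (λ z → gadgetOf (suc z) (f (fsuc j))) (≡.sym (+-suc offset (toℕ j))))

  gadgetsFrom-dummy : ∀ n f t offset → gadgetsFrom n f (n + t) offset ≡ dummy t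
  gadgetsFrom-dummy zero f t offset = refl
  gadgetsFrom-dummy (suc n) f t offset = gadgetsFrom-dummy n (λ i → f (fsuc i)) t (suc offset)

-- Arithmetic of the alignment

dbl≡+ : ∀ n → dbl n ≡ n + n
dbl≡+ zero = refl
dbl≡+ (suc n) = cong suc (trans (cong suc (dbl≡+ n)) (≡.sym (+-suc n n)))

-- A linear consequence L ≡ R of a hypothesis X ≡ Y, reduced to the ring identity L + Y ≡ R + X (proved by solve-∀).
cancel-by : ∀ {L R X Y} → X ≡ Y → L + Y ≡ R + X → L ≡ R
cancel-by {L} {R} {X} {Y} h e = +-cancelʳ-≡ Y L R (trans e (cong (R +_) h))

≤-by : ∀ {m n o} → m + o ≡ n → m ≤ n
≤-by {m} {o = o} refl = m≤m+n m o

2M+N≡ : ∀ i₁ i₂ n → suc (suc (dbl (i₁ + suc (suc i₂)) + dbl (dbl (suc n)))) ≡ 2 * suc (i₁ + suc (suc i₂)) + dbl (dbl (suc n))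
2M+N≡ i₁ i₂ n rewrite dbl≡+ (i₁ + suc (suc i₂)) | dbl≡+ (dbl n) | dbl≡+ n = identity i₁ i₂ n
  where
  identity : ∀ i₁ i₂ n → suc (suc ((i₁ + suc (suc i₂)) + (i₁ + suc (suc i₂)) + suc (suc (suc (suc ((n + n) + (n + n)))))))
                         ≡ 2 * suc (i₁ + suc (suc i₂)) + suc (suc (suc (suc ((n + n) + (n + n)))))
  identity = solve-∀

record LeftPlan (i₁ i₂ n u j : ℕ) : Set where
  field
    tL sL mL pL : ℕ
    reach : tL + (suc sL + mL) ≡ i₂ + dbl (suc n) + j
    prefix-count : suc pL + tL ≡ 2 * suc (i₁ + suc (suc i₂)) + dbl (dbl (suc n))
    left-count : dbl (suc sL) + (mL + 1) ≡ dbl (dbl (suc n)) ∸ 1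
    tL≤ : tL ≤ dbl (u + suc (suc n))

leftPlan : ∀ i₁ i₂ n u j jr → j + suc jr ≡ dbl (dbl (suc n)) → i₁ + i₂ ≡ dbl u → LeftPlan i₁ i₂ n u j
leftPlan i₁ i₂ n u j jr hj hu with ≤-total (i₂ + j + 1) (dbl n)
... | inj₁ le with m≤n⇒∃[o]m+o≡n le
...   | c , hc = record
  { tL = 0 ; sL = c ; mL = dbl (suc (i₂ + j)) ; pL = suc (dbl (i₁ + suc (suc i₂)) + dbl (dbl (suc n)))
  ; reach = reach ; prefix-count = trans (+-identityʳ _) (2M+N≡ i₁ i₂ n) ; left-count = count ; tL≤ = z≤n }
  where
  reach : suc c + dbl (suc (i₂ + j)) ≡ i₂ + dbl (suc n) + j
  reach rewrite dbl≡+ (i₂ + j) | dbl≡+ n = cancel-by hc (identity c i₂ j n)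
    where
    identity : ∀ c i₂ j n → (suc c + suc (suc ((i₂ + j) + (i₂ + j)))) + (n + n) ≡ (i₂ + suc (suc (n + n)) + j) + (i₂ + j + 1 + c)
    identity = solve-∀
  count : dbl (suc c) + (dbl (suc (i₂ + j)) + 1) ≡ suc (suc (suc (dbl (dbl n))))
  count rewrite dbl≡+ c | dbl≡+ (i₂ + j) | dbl≡+ (dbl n) | dbl≡+ n = cancel-by (cong₂ _+_ hc hc) (identity c i₂ j n)
    where
    identity : ∀ c i₂ j n → suc (suc (c + c)) + (suc (suc ((i₂ + j) + (i₂ + j))) + 1) + ((n + n) + (n + n))
                            ≡ suc (suc (suc ((n + n) + (n + n)))) + ((i₂ + j + 1 + c) + (i₂ + j + 1 + c))
    identity = solve-∀
leftPlan i₁ i₂ n u j jr hj hu | inj₂ le with m≤n⇒∃[o]m+o≡n le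
...   | c , hc = record
  { tL = c ; sL = 0 ; mL = dbl (dbl n) ; pL = (i₁ + jr) + (i₁ + i₂ + 3 + dbl (suc n))
  ; reach = reach ; prefix-count = prefix ; left-count = cong (λ z → suc (suc z)) (+-comm (dbl (dbl n)) 1) ; tL≤ = ≤-by bound }
  where
  reach : c + (1 + dbl (dbl n)) ≡ i₂ + dbl (suc n) + j
  reach rewrite dbl≡+ (dbl n) | dbl≡+ n = cancel-by hc (identity c i₂ j n)
    where
    identity : ∀ c i₂ j n → (c + (1 + ((n + n) + (n + n)))) + (i₂ + j + 1) ≡ (i₂ + suc (suc (n + n)) + j) + ((n + n) + c)
    identity = solve-∀
  prefix : suc ((i₁ + jr) + (i₁ + i₂ + 3 + dbl (suc n))) + c ≡ 2 * suc (i₁ + suc (suc i₂)) + dbl (dbl (suc n))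
  prefix rewrite dbl≡+ (dbl n) | dbl≡+ n = cancel-by (cong₂ _+_ hc hj) (identity c i₁ i₂ j jr n)
    where
    identity : ∀ c i₁ i₂ j jr n →
      (suc ((i₁ + jr) + (i₁ + i₂ + 3 + suc (suc (n + n)))) + c) + ((i₂ + j + 1) + suc (suc (suc (suc ((n + n) + (n + n))))))
        ≡ (2 * suc (i₁ + suc (suc i₂)) + suc (suc (suc (suc ((n + n) + (n + n)))))) + (((n + n) + c) + (j + suc jr))
    identity = solve-∀
  bound : c + (i₁ + jr) ≡ dbl (u + suc (suc n))
  bound rewrite dbl≡+ (u + suc (suc n)) | dbl≡+ (dbl n) | dbl≡+ n | dbl≡+ u =
    cancel-by (cong₂ _+_ (cong₂ _+_ hc hj) hu) (identity c i₁ i₂ u j jr n)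
    where
    identity : ∀ c i₁ i₂ u j jr n →
      (c + (i₁ + jr)) + (((i₂ + j + 1) + suc (suc (suc (suc ((n + n) + (n + n)))))) + (u + u))
        ≡ ((u + suc (suc n)) + (u + suc (suc n))) + ((((n + n) + c) + (j + suc jr)) + (i₁ + i₂))
    identity = solve-∀

record RightPlan (i₁ i₂ n u jr : ℕ) : Set where
  field
    sR mR tR pR : ℕ
    reach : sR + (mR + suc tR) ≡ i₁ + dbl (suc n) + jr
    right-count : dbl sR + (mR + 1) ≡ dbl (dbl (suc n)) ∸ 1
    suffix-count : tR + suc pR ≡ 2 * suc (i₁ + suc (suc i₂)) + dbl (dbl (suc n))
    tR< : suc tR ≤ dbl (u + suc (suc n))

rightPlan : ∀ i₁ i₂ n u j jr → j + suc jr ≡ dbl (dbl (suc n)) → i₁ + i₂ ≡ dbl u → RightPlan i₁ i₂ n u jr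
rightPlan i₁ i₂ n u j jr hj hu with ≤-total (i₁ + jr) (suc (dbl n))
... | inj₁ le with m≤n⇒∃[o]m+o≡n le
...   | c , hc = record
  { sR = c ; mR = dbl (i₁ + jr) ; tR = 0 ; pR = suc (dbl (i₁ + suc (suc i₂)) + dbl (dbl (suc n)))
  ; reach = reach ; right-count = count ; suffix-count = 2M+N≡ i₁ i₂ n
  ; tR< = subst (1 ≤_) (cong dbl (≡.sym (+-suc u (suc n)))) (s≤s z≤n) }
  where
  reach : c + (dbl (i₁ + jr) + 1) ≡ i₁ + dbl (suc n) + jr
  reach rewrite dbl≡+ (i₁ + jr) | dbl≡+ n = cancel-by hc (identity c i₁ jr n)
    where
    identity : ∀ c i₁ jr n → (c + (((i₁ + jr) + (i₁ + jr)) + 1)) + suc (n + n) ≡ (i₁ + suc (suc (n + n)) + jr) + (i₁ + jr + c)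
    identity = solve-∀
  count : dbl c + (dbl (i₁ + jr) + 1) ≡ suc (suc (suc (dbl (dbl n))))
  count rewrite dbl≡+ c | dbl≡+ (i₁ + jr) | dbl≡+ (dbl n) | dbl≡+ n = cancel-by (cong₂ _+_ hc hc) (identity c i₁ jr n)
    where
    identity : ∀ c i₁ jr n → ((c + c) + (((i₁ + jr) + (i₁ + jr)) + 1)) + (suc (n + n) + suc (n + n))
                             ≡ suc (suc (suc ((n + n) + (n + n)))) + ((i₁ + jr + c) + (i₁ + jr + c))
    identity = solve-∀
rightPlan i₁ i₂ n u j jr hj hu | inj₂ le with m≤n⇒∃[o]m+o≡n le
...   | c , hc = record
  { sR = 0 ; mR = suc (suc (dbl (dbl n))) ; tR = c ; pR = i₁ + i₂ + i₂ + j + dbl n + 7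
  ; reach = reach ; right-count = cong (λ z → suc (suc z)) (+-comm (dbl (dbl n)) 1) ; suffix-count = suffix
  ; tR< = ≤-by bound }
  where
  reach : suc (suc (dbl (dbl n))) + suc c ≡ i₁ + dbl (suc n) + jr
  reach rewrite dbl≡+ (dbl n) | dbl≡+ n = cancel-by hc (identity c i₁ jr n)
    where
    identity : ∀ c i₁ jr n → (suc (suc ((n + n) + (n + n))) + suc c) + (i₁ + jr) ≡ (i₁ + suc (suc (n + n)) + jr) + (suc (n + n) + c)
    identity = solve-∀
  suffix : c + suc (i₁ + i₂ + i₂ + j + dbl n + 7) ≡ 2 * suc (i₁ + suc (suc i₂)) + dbl (dbl (suc n))
  suffix rewrite dbl≡+ (dbl n) | dbl≡+ n = cancel-by (cong₂ _+_ hc hj) (identity c i₁ i₂ j jr n)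
    where
    identity : ∀ c i₁ i₂ j jr n →
      (c + suc (i₁ + i₂ + i₂ + j + (n + n) + 7)) + ((i₁ + jr) + suc (suc (suc (suc ((n + n) + (n + n))))))
        ≡ (2 * suc (i₁ + suc (suc i₂)) + suc (suc (suc (suc ((n + n) + (n + n)))))) + ((suc (n + n) + c) + (j + suc jr))
    identity = solve-∀
  bound : suc c + (i₂ + j + 1) ≡ dbl (u + suc (suc n))
  bound rewrite dbl≡+ (u + suc (suc n)) | dbl≡+ (dbl n) | dbl≡+ n | dbl≡+ u =
    cancel-by (cong₂ _+_ (cong₂ _+_ hc hj) hu) (identity c i₁ i₂ u j jr n)
    where
    identity : ∀ c i₁ i₂ u j jr n →
      (suc c + (i₂ + j + 1)) + (((i₁ + jr) + suc (suc (suc (suc ((n + n) + (n + n)))))) + (u + u))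
        ≡ ((u + suc (suc n)) + (u + suc (suc n))) + (((suc (n + n) + c) + (j + suc jr)) + (i₁ + i₂))
    identity = solve-∀

countA : ℕ → ℕ → ℕ
countA i₁ i₂ = suc (i₁ + suc (suc i₂))

countB : ℕ → ℕ
countB n = dbl (dbl (suc n))

-- M = countA i₁ i₂ with the orthogonal α at index i₁ + 1, N = countB n, and the orthogonal β at index j.
-- The word consists of tL all-y and pL + 1 striped blocks, the units absorb^tL split^(sL+1) merge^mL split
-- (split^i₁ split merge merge split^i₂) split split^sR merge^mR absorb^(tR+1), then tR all-y and pR + 1
-- striped blocks; ℬ uses ρ copies of P on each side.
record Plan (i₁ i₂ n j : ℕ) : Set where
  field
    ρ tL sL mL sR mR tR pL pR : ℕ
    ρ-def : (2 * countA i₁ i₂ + countB n ∸ 2) / 4 ≡ ρ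
    prefix-count : suc pL + tL ≡ 2 * countA i₁ i₂ + countB n
    left-count : dbl (suc sL) + (mL + 1) ≡ countB n ∸ 1
    left-parity : isOdd (tL + ((suc sL + mL) + 0)) ≡ true
    aligned : tL + ((suc sL + mL) + suc (suc i₁)) ≡ dbl ρ + j
    right-parity : isOdd (tL + ((suc sL + mL) + suc ((i₁ + suc (suc (suc i₂))) + 0))) ≡ true
    right-count : dbl sR + (mR + 1) ≡ countB n ∸ 1
    suffix-count : tR + suc pR ≡ 2 * countA i₁ i₂ + countB n
    tL≤ : tL ≤ dbl ρ
    tR< : suc tR ≤ dbl ρ
    total : tL + (((suc sL + mL) + suc ((i₁ + suc (suc (suc i₂))) + suc (sR + mR))) + suc tR) ≡ dbl ρ + (countB n + dbl ρ)

xor≡false⇒xor-not≡true : ∀ a b → a xor b ≡ false → b xor not a ≡ true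
xor≡false⇒xor-not≡true true true _ = refl
xor≡false⇒xor-not≡true false false _ = refl

module _ (i₁ i₂ n u j jr : ℕ) (hu : i₁ + i₂ ≡ dbl u) (hj : j + suc jr ≡ countB n) where

  reach-parity : isOdd (suc i₁) ≡ isOdd j → isOdd (i₂ + dbl (suc n) + j) ≡ true
  reach-parity hp = begin
    isOdd (i₂ + dbl (suc n) + j)        ≡⟨ isOdd-+ (i₂ + dbl (suc n)) j ⟩
    isOdd (i₂ + dbl (suc n)) xor isOdd j ≡⟨ cong₂ _xor_ (isOdd-+-even i₂ (dbl (suc n)) (isOdd-dbl (suc n))) (trans (≡.sym hp) (isOdd-suc i₁)) ⟩
    isOdd i₂ xor not (isOdd i₁)          ≡⟨ xor≡false⇒xor-not≡true (isOdd i₁) (isOdd i₂)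
                                              (trans (≡.sym (isOdd-+ i₁ i₂)) (trans (cong isOdd hu) (isOdd-dbl u))) ⟩
    true                                 ∎

  reach-aligned : (i₂ + dbl (suc n) + j) + suc (suc i₁) ≡ dbl (u + suc (suc n)) + j
  reach-aligned rewrite dbl≡+ (u + suc (suc n)) | dbl≡+ n | dbl≡+ u = cancel-by hu (identity i₁ i₂ u j n)
    where
    identity : ∀ i₁ i₂ u j n → (i₂ + suc (suc (n + n)) + j) + suc (suc i₁) + (u + u)
                               ≡ (((u + suc (suc n)) + (u + suc (suc n))) + j) + (i₁ + i₂)
    identity = solve-∀

  middle-even : suc ((i₁ + suc (suc (suc i₂))) + 0) ≡ dbl (suc (suc u))
  middle-even rewrite dbl≡+ u = cancel-by hu (identity i₁ i₂ u)
    where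
    identity : ∀ i₁ i₂ u → suc ((i₁ + suc (suc (suc i₂))) + 0) + (u + u) ≡ suc (suc (suc (suc (u + u)))) + (i₁ + i₂)
    identity = solve-∀

  reach-total : (i₂ + dbl (suc n) + j) + (suc (suc (i₁ + suc (suc (suc i₂)))) + (i₁ + dbl (suc n) + jr))
                ≡ dbl (u + suc (suc n)) + (countB n + dbl (u + suc (suc n)))
  reach-total rewrite dbl≡+ (u + suc (suc n)) | dbl≡+ (dbl n) | dbl≡+ n | dbl≡+ u =
    cancel-by (cong₂ _+_ (cong₂ _+_ hu hu) hj) (identity i₁ i₂ u j jr n)
    where
    identity : ∀ i₁ i₂ u j jr n →
      (i₂ + suc (suc (n + n)) + j) + (suc (suc (i₁ + suc (suc (suc i₂)))) + (i₁ + suc (suc (n + n)) + jr))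
        + (((u + u) + (u + u)) + suc (suc (suc (suc ((n + n) + (n + n))))))
        ≡ ((u + suc (suc n)) + (u + suc (suc n))) + (suc (suc (suc (suc ((n + n) + (n + n))))) + ((u + suc (suc n)) + (u + suc (suc n))))
          + (((i₁ + i₂) + (i₁ + i₂)) + (j + suc jr))
    identity = solve-∀

  2M+N≡4ρ+2 : 2 * countA i₁ i₂ + countB n ≡ 2 + (u + suc (suc n)) * 4
  2M+N≡4ρ+2 rewrite dbl≡+ (dbl n) | dbl≡+ n | dbl≡+ u = cancel-by (cong₂ _+_ hu hu) (identity i₁ i₂ u n)
    where
    identity : ∀ i₁ i₂ u n → (2 * suc (i₁ + suc (suc i₂)) + suc (suc (suc (suc ((n + n) + (n + n)))))) + ((u + u) + (u + u))
                             ≡ (2 + (u + suc (suc n)) * 4) + ((i₁ + i₂) + (i₁ + i₂))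
    identity = solve-∀

  plan : isOdd (suc i₁) ≡ isOdd j → Plan i₁ i₂ n j
  plan hp = record
    { ρ = ρ ; tL = L.tL ; sL = L.sL ; mL = L.mL ; sR = R.sR ; mR = R.mR ; tR = R.tR ; pL = L.pL ; pR = R.pR
    ; ρ-def = trans (cong (λ z → (z ∸ 2) / 4) 2M+N≡4ρ+2) (trans (cong (_/ 4) (m+n∸m≡n 2 (ρ * 4))) (m*n/n≡m ρ 4))
    ; prefix-count = L.prefix-count
    ; left-count = L.left-count
    ; left-parity = trans (cong isOdd (trans (cong (L.tL +_) (+-identityʳ left)) L.reach)) (reach-parity hp)
    ; aligned = trans (≡.sym (+-assoc L.tL left (suc (suc i₁)))) (trans (cong (_+ suc (suc i₁)) L.reach) reach-aligned)
    ; right-parity = trans (cong isOdd (trans (≡.sym (+-assoc L.tL left _))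
                                        (trans (cong (_+ suc (middle + 0)) L.reach) (cong ((i₂ + dbl (suc n) + j) +_) middle-even))))
                           (trans (isOdd-+-even (i₂ + dbl (suc n) + j) (dbl (suc (suc u))) (isOdd-dbl (suc (suc u)))) (reach-parity hp))
    ; right-count = R.right-count
    ; suffix-count = R.suffix-count
    ; tL≤ = L.tL≤
    ; tR< = R.tR<
    ; total = trans (regroup L.tL left middle R.sR R.mR R.tR)
                    (trans (cong₂ (λ a b → a + (suc (suc middle) + b)) L.reach R.reach) reach-total)
    }
    where
    module L = LeftPlan (leftPlan i₁ i₂ n u j jr hj hu)
    module R = RightPlan (rightPlan i₁ i₂ n u j jr hj hu)
    ρ = u + suc (suc n)
    left = suc L.sL + L.mL
    middle = i₁ + suc (suc (suc i₂))
    regroup : ∀ a b c d e f → a + ((b + suc (c + suc (d + e))) + suc f) ≡ (a + b) + (suc (suc c) + (d + (e + suc f)))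
    regroup = solve-∀

splitAt-≤ : ∀ {A : Set} n (xs : List A) → n ≤ length xs → ∃₂ λ ys zs → xs ≡ ys ++ zs × length ys ≡ n
splitAt-≤ zero xs _ = [] , xs , refl , refl
splitAt-≤ (suc n) (z ∷ zs) (s≤s le) with splitAt-≤ n zs le
... | xs , ys , e , l = z ∷ xs , ys , cong (z ∷_) e , cong suc l

three-way-split : ∀ {A : Set} {P : A → Set} (e : A) R n a b (mid : List A) → a ≤ R → b ≤ R →
  a + (length mid + b) ≡ R + (n + R) → All P mid →
  ∃₂ λ xs ys → ∃ λ zs → replicate a e ++ mid ++ replicate b e ≡ xs ++ ys ++ zs
                       × length xs ≡ R × length ys ≡ n × length zs ≡ R × All P ys
three-way-split {P = P} e R n a b mid a≤R b≤R H all =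
  replicate a e ++ mA , mC , mD ++ replicate b e , eq , length-xs , |mC| , length-zs , ++⁻ˡ mC (++⁻ʳ mA (subst (All P) mid≡ all))
  where
  u = proj₁ (m≤n⇒∃[o]m+o≡n a≤R)
  a+u≡R : a + u ≡ R
  a+u≡R = proj₂ (m≤n⇒∃[o]m+o≡n a≤R)
  H′ : length mid + b ≡ u + (n + R)
  H′ = +-cancelˡ-≡ a _ _ (trans H (trans (cong (_+ (n + R)) (≡.sym a+u≡R)) (+-assoc a u (n + R))))
  u+n≤ : u + n ≤ length mid
  u+n≤ = +-cancelʳ-≤ b (u + n) (length mid) (≤-trans (+-monoʳ-≤ (u + n) b≤R) (≤-reflexive (trans (+-assoc u n R) (≡.sym H′))))
  splitA = splitAt-≤ u mid (≤-trans (m≤m+n u n) u+n≤)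
  mA = proj₁ splitA
  mB = proj₁ (proj₂ splitA)
  mid≡A : mid ≡ mA ++ mB
  mid≡A = proj₁ (proj₂ (proj₂ splitA))
  |mA| : length mA ≡ u
  |mA| = proj₂ (proj₂ (proj₂ splitA))
  |mid|≡ : length mid ≡ u + length mB
  |mid|≡ = trans (cong length mid≡A) (trans (length-++ mA) (cong (_+ length mB) |mA|))
  splitB = splitAt-≤ n mB (+-cancelˡ-≤ u n (length mB) (≤-trans u+n≤ (≤-reflexive |mid|≡)))
  mC = proj₁ splitB
  mD = proj₁ (proj₂ splitB)
  mB≡ : mB ≡ mC ++ mD
  mB≡ = proj₁ (proj₂ (proj₂ splitB))
  |mC| : length mC ≡ n
  |mC| = proj₂ (proj₂ (proj₂ splitB))
  mid≡ : mid ≡ mA ++ mC ++ mD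
  mid≡ = trans mid≡A (cong (mA ++_) mB≡)
  eq : replicate a e ++ mid ++ replicate b e ≡ (replicate a e ++ mA) ++ mC ++ mD ++ replicate b e
  eq = begin
    replicate a e ++ mid ++ replicate b e               ≡⟨ cong (λ z → replicate a e ++ z ++ replicate b e) mid≡ ⟩
    replicate a e ++ (mA ++ mC ++ mD) ++ replicate b e  ≡⟨ cong (replicate a e ++_) (++-assoc mA (mC ++ mD) _) ⟩
    replicate a e ++ mA ++ (mC ++ mD) ++ replicate b e  ≡⟨ cong (λ z → replicate a e ++ mA ++ z) (++-assoc mC mD _) ⟩
    replicate a e ++ mA ++ mC ++ mD ++ replicate b e    ≡⟨ ≡.sym (++-assoc (replicate a e) mA _) ⟩
    (replicate a e ++ mA) ++ mC ++ mD ++ replicate b e  ∎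
  length-xs : length (replicate a e ++ mA) ≡ R
  length-xs = trans (length-++ (replicate a e)) (trans (cong₂ _+_ (length-replicate a) |mA|) a+u≡R)
  length-zs : length (mD ++ replicate b e) ≡ R
  length-zs = trans (length-++ mD) (trans (cong (length mD +_) (length-replicate b)) (+-cancelˡ-≡ n _ _ (+-cancelˡ-≡ u _ _ (begin
    u + (n + (length mD + b))  ≡⟨ cong (u +_) (≡.sym (+-assoc n (length mD) b)) ⟩
    u + ((n + length mD) + b)  ≡⟨ ≡.sym (+-assoc u _ b) ⟩
    (u + (n + length mD)) + b  ≡⟨ cong (λ z → (u + z) + b) (≡.sym (trans (length-++ mC) (cong (_+ length mD) |mC|))) ⟩
    (u + length (mC ++ mD)) + b ≡⟨ cong (λ z → (u + length z) + b) (≡.sym mB≡) ⟩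
    (u + length mB) + b        ≡⟨ cong (_+ b) (≡.sym |mid|≡) ⟩
    length mid + b             ≡⟨ H′ ⟩
    u + (n + R)                ∎))))

-- The common word

module Witness (k i₁ i₂ n : ℕ) (α : Fin (countA i₁ i₂) → Vec Bool (dim k)) (β : Fin (countB n) → Vec Bool (dim k))
  (i₀ : Fin (countA i₁ i₂)) (i₀≡ : toℕ i₀ ≡ suc i₁) (j₀ : Fin (countB n)) (pl : Plan i₁ i₂ n (toℕ j₀))
  (amid bmid : List Bool) (α-framed : Framed k true (toList (α i₀)) amid) (β-framed : Framed k false (toList (β j₀)) bmid)
  (orth : Orthogonal amid bmid) (βs-framed : ∀ j → ∃ (Framed k false (toList (β j)))) where

  open Plan pl
  open Units k
  open GadgetSequence k (countB n) β

  M N : ℕ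
  M = countA i₁ i₂
  N = countB n

  solids stripeds : ℕ → List Sym
  solids zero = []
  solids (suc c) = solid K ++ solids c
  stripeds zero = []
  stripeds (suc c) = striped K ++ stripeds c

  stripeds∈a0 : ∀ c → stripeds c ∈L rep c (a0 d)
  stripeds∈a0 zero = eps
  stripeds∈a0 (suc c) = cat striped∈a0 (stripeds∈a0 c)

  solids-allY : ∀ c → AllY (solids c)
  solids-allY zero = []
  solids-allY (suc c) = ++⁺ (solid-allY K) (solids-allY c)

  blocks∈a0 : ∀ c q → (solids c ++ stripeds (suc q)) ∈L rep (suc q) (a0 d)
  blocks∈a0 c q = ∈L-resp-≡ (++-assoc (solids c) (striped K) (stripeds q))
    (cat (fromA0 (A0-prepend-allY (solids-allY c) (toA0 striped∈a0))) (stripeds∈a0 q))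

  blocks∈b0 : ∀ c q → (solids c ++ stripeds q) ∈L rep (c + q) (b0 d)
  blocks∈b0 c q = rep-+ (solids∈b0 c) (stripeds∈b0 q)
    where
    solids∈b0 : ∀ c → solids c ∈L rep c (b0 d)
    solids∈b0 zero = eps
    solids∈b0 (suc c) = cat (blockWord∈b0 absorb) (solids∈b0 c)
    stripeds∈b0 : ∀ c → stripeds c ∈L rep c (b0 d)
    stripeds∈b0 zero = eps
    stripeds∈b0 (suc c) = cat (blockWord∈b0 split) (stripeds∈b0 c)

  left middle right absorbsR afterMiddle afterLeft modes : List Mode
  left = replicate (suc sL) split ++ replicate mL merge
  middle = replicate i₁ split ++ split ∷ merge ∷ merge ∷ replicate i₂ split
  right = replicate sR split ++ replicate mR merge
  absorbsR = replicate (suc tR) absorb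
  afterMiddle = split ∷ right ++ absorbsR
  afterLeft = split ∷ middle ++ afterMiddle
  modes = replicate tL absorb ++ left ++ afterLeft

  prefix suffix word : List Sym
  prefix = solids tL ++ stripeds (suc pL)
  suffix = solids tR ++ stripeds (suc pR)
  word = prefix ++ unitsWord modes (gadgets ρ) ++ suffix

  length-replicate-++ : ∀ a b (m m′ : Mode) → length (replicate a m ++ replicate b m′) ≡ a + b
  length-replicate-++ a b m m′ = trans (length-++ (replicate a m)) (cong₂ _+_ (length-replicate a) (length-replicate b))

  length-middle : length middle ≡ i₁ + suc (suc (suc i₂))
  length-middle = trans (length-++ (replicate i₁ split)) (cong₂ (λ a b → a + suc (suc (suc b))) (length-replicate i₁) (length-replicate i₂))

  G g₁ g₁′ g₂ g₃ g₄ g₅ g₅′ g₆ g₇ : ℕ → List Sym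
  G = gadgets ρ
  g₁ t = G (tL + t)
  g₁′ t = g₁ (suc sL + t)
  g₂ t = g₁ (length left + t)
  g₃ t = g₂ (suc t)
  g₄ t = g₃ (length middle + t)
  g₅ t = g₄ (suc t)
  g₅′ t = g₅ (sR + t)
  g₆ t = g₅ (length right + t)
  g₇ t = g₆ (suc t)

  fit : ∀ t → G t ∈L a0 d
  fit = gadgets∈a0 ρ

  𝒜₄ 𝒜₃ 𝒜₂ 𝒜₁ : Regex
  𝒜₄ = rep (N ∸ 1) (s $ · a0 d) · rep (2 * M + N) (a0 d)
  𝒜₃ = s $ · aEven d · 𝒜₄
  𝒜₂ = aEven d · s $ · APerp α β · 𝒜₃
  𝒜₁ = rep (N ∸ 1) (a0 d · s $) · 𝒜₂

  right∈𝒜₄ : ($ ∷ unitsWord (right ++ absorbsR) g₅ ++ suffix) ∈L 𝒜₄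
  right∈𝒜₄ = ∈L-resp-≡ (cong ($ ∷_) (≡.sym eq))
    (rep·-resp-≡ right-count ($splits∈$a0 sR g₅ (λ t → fit _) ($merges∈$a0 mR g₅′ (λ t → fit _) absorbsR∈)))
    where
    Z = unitsWord absorbsR g₆ ++ suffix
    absorbsR∈ : ($ ∷ Z) ∈L (rep 1 (s $ · a0 d) · rep (2 * M + N) (a0 d))
    absorbsR∈ = ∈L-resp-≡ (cong ($ ∷_) (≡.sym (++-assoc (unitWord absorb (g₆ 0)) _ suffix)))
      (rep-suc· (cat (sym $) (absorbed∈a0 (fit _)))
                (cat eps (rep-resp-≡ suffix-count (rep·rep⇒rep (absorbs∈a0 tR g₇ (λ t → fit _) (blocks∈a0 tR pR))))))
    eq : unitsWord (right ++ absorbsR) g₅ ++ suffix ≡ unitsWord (replicate sR split) g₅ ++ unitsWord (replicate mR merge) g₅′ ++ Z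
    eq = begin
      unitsWord (right ++ absorbsR) g₅ ++ suffix
        ≡⟨ cong (_++ suffix) (unitsWord-++ right absorbsR g₅) ⟩
      (unitsWord right g₅ ++ unitsWord absorbsR g₆) ++ suffix
        ≡⟨ ++-assoc (unitsWord right g₅) _ suffix ⟩
      unitsWord right g₅ ++ Z
        ≡⟨ cong (_++ Z) (unitsWord-replicate-++ sR split (replicate mR merge) g₅) ⟩
      (unitsWord (replicate sR split) g₅ ++ unitsWord (replicate mR merge) g₅′) ++ Z
        ≡⟨ ++-assoc (unitsWord (replicate sR split) g₅) _ Z ⟩
      unitsWord (replicate sR split) g₅ ++ unitsWord (replicate mR merge) g₅′ ++ Z ∎

  rightGadget∈aEven : g₄ 0 ∈L aEven d
  rightGadget∈aEven = gadgets∈aEven ρ _ βs-framed (isOdd-dbl (dbl (suc n)))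
    (subst₂ (λ a b → isOdd (tL + (a + suc (b + 0))) ≡ true)
            (≡.sym (length-replicate-++ (suc sL) mL split merge)) (≡.sym length-middle) right-parity)

  Q : List Sym
  Q = $ ∷ g₄ 0 ++ $ ∷ unitsWord (right ++ absorbsR) g₅ ++ suffix

  pieces : ℕ → List Sym
  pieces zero = striped K
  pieces (suc i) = piece i₁ g₃ i

  middle-pieces : unitsWord (middle ++ afterMiddle) g₃ ++ suffix ≡ concatUpTo pieces M ++ Q
  middle-pieces = begin
    unitsWord (middle ++ afterMiddle) g₃ ++ suffix
      ≡⟨ cong (_++ suffix) (unitsWord-++ middle afterMiddle g₃) ⟩
    (unitsWord middle g₃ ++ unitsWord afterMiddle g₄) ++ suffix
      ≡⟨ ++-assoc (unitsWord middle g₃) _ suffix ⟩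
    unitsWord middle g₃ ++ unitsWord afterMiddle g₄ ++ suffix
      ≡⟨ cong (unitsWord middle g₃ ++_) (unitsWord-suc-++ split (right ++ absorbsR) g₄ suffix) ⟩
    unitsWord middle g₃ ++ striped K ++ Q
      ≡⟨ middle-regroup i₁ i₂ g₃ Q ⟩
    striped K ++ concatUpTo (piece i₁ g₃) (i₁ + suc (suc i₂)) ++ Q
      ≡⟨ ≡.sym (++-assoc (striped K) _ Q) ⟩
    concatUpTo pieces M ++ Q ∎

  merged-gadget : g₃ (suc i₁) ≡ gadgetOf (suc (toℕ j₀)) (β j₀)
  merged-gadget = begin
    G (tL + (length left + suc (suc i₁)))      ≡⟨ cong (λ z → G (tL + (z + suc (suc i₁)))) (length-replicate-++ (suc sL) mL split merge) ⟩
    G (tL + ((suc sL + mL) + suc (suc i₁)))    ≡⟨ cong G aligned ⟩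
    G (dbl ρ + toℕ j₀)                         ≡⟨ gadgets-shift ρ (toℕ j₀) ⟩
    realGadgets (toℕ j₀)                       ≡⟨ gadgetsFrom-real N β j₀ 0 ⟩
    gadgetOf (suc (toℕ j₀)) (β j₀)             ∎

  mergedGadget∈aPerp : mergedWord (g₃ (suc i₁)) ∈L aPerp (α i₀)
  mergedGadget∈aPerp =
    subst (λ w → mergedWord w ∈L aPerp (α i₀)) (≡.sym merged-gadget)
      (subst (λ l → mergedWord (gadgetWord o l) ∈L aPerp (α i₀)) (≡.sym (proj₁ β-framed))
        (subst (λ l → mergedWord (gadgetWord o (false ∷ bmid ++ [ false ])) ∈L encode C-A 1 l) (≡.sym (proj₁ α-framed))
          (merged∈encode-C-A k amid bmid o (proj₂ α-framed) (proj₂ β-framed) orth)))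
    where o = isOdd (suc (toℕ j₀))

  merged-piece : ∀ (j : Fin (i₁ + suc (suc i₂))) → toℕ j ≡ i₁ → mergedWord (g₃ (suc (toℕ j))) ∈L aPerp (α (fsuc j))
  merged-piece j e rewrite e | toℕ-injective {i = fsuc j} {j = i₀} (trans (cong suc e) (≡.sym i₀≡)) = mergedGadget∈aPerp

  middle∈ : (unitsWord (middle ++ afterMiddle) g₃ ++ suffix) ∈L (APerp α β · 𝒜₃)
  middle∈ = ∈L-resp-≡ (≡.sym middle-pieces) (concatUpTo∈concatR M _ pieces piece∈APerp (cat (sym $) (cat rightGadget∈aEven right∈𝒜₄)))
    where
    piece∈APerp : ∀ j → pieces (toℕ j) ∈L _
    piece∈APerp fzero = striped∈aPerp (α fzero)
    piece∈APerp (fsuc j) = piece∈ i₁ g₃ (toℕ j) (aPerp (α (fsuc j))) (λ t → fit _) (striped∈aPerp _) (merged-piece j)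

  leftGadget∈aEven : g₂ 0 ∈L aEven d
  leftGadget∈aEven = gadgets∈aEven ρ _ βs-framed (isOdd-dbl (dbl (suc n)))
    (subst (λ a → isOdd (tL + (a + 0)) ≡ true) (≡.sym (length-replicate-++ (suc sL) mL split merge)) left-parity)

  afterLeft∈ : (unitsWord afterLeft g₂ ++ suffix) ∈L (rep 1 (a0 d · s $) · 𝒜₂)
  afterLeft∈ = ∈L-resp-≡ (≡.sym (unitsWord-suc-++ split (middle ++ afterMiddle) g₂ suffix))
    (rep-suc-snoc· striped∈a0 (cat eps (cat leftGadget∈aEven (cat (sym $) middle∈))))

  left∈𝒜₁ : (unitsWord (left ++ afterLeft) g₁ ++ suffix) ∈L 𝒜₁
  left∈𝒜₁ = ∈L-resp-≡ (≡.sym eq)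
    (rep·-resp-≡ left-count (splits∈a0$ (suc sL) g₁ (λ t → fit _) (merges∈a0$ mL g₁′ (λ t → fit _) afterLeft∈)))
    where
    Z = unitsWord afterLeft g₂ ++ suffix
    eq : unitsWord (left ++ afterLeft) g₁ ++ suffix ≡ unitsWord (replicate (suc sL) split) g₁ ++ unitsWord (replicate mL merge) g₁′ ++ Z
    eq = begin
      unitsWord (left ++ afterLeft) g₁ ++ suffix
        ≡⟨ cong (_++ suffix) (unitsWord-++ left afterLeft g₁) ⟩
      (unitsWord left g₁ ++ unitsWord afterLeft g₂) ++ suffix
        ≡⟨ ++-assoc (unitsWord left g₁) _ suffix ⟩
      unitsWord left g₁ ++ Z
        ≡⟨ cong (_++ Z) (unitsWord-replicate-++ (suc sL) split (replicate mL merge) g₁) ⟩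
      (unitsWord (replicate (suc sL) split) g₁ ++ unitsWord (replicate mL merge) g₁′) ++ Z
        ≡⟨ ++-assoc (unitsWord (replicate (suc sL) split) g₁) _ Z ⟩
      unitsWord (replicate (suc sL) split) g₁ ++ unitsWord (replicate mL merge) g₁′ ++ Z ∎

  word∈𝒜 : word ∈L 𝒜 α β
  word∈𝒜 = rep·-resp-≡ prefix-count (rep-+· (blocks∈a0 tL pL)
    (∈L-resp-≡ (≡.sym (trans (cong (_++ suffix) (unitsWord-replicate-++ tL absorb (left ++ afterLeft) G))
                             (++-assoc (unitsWord (replicate tL absorb) G) _ suffix)))
               (absorbs∈a0 tL G fit left∈𝒜₁)))

  core : List Mode
  core = left ++ split ∷ middle ++ split ∷ right

  afterAbsorbs≡ : left ++ afterLeft ≡ core ++ absorbsR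
  afterAbsorbs≡ = ≡.sym (trans (++-assoc left _ absorbsR) (cong (λ z → left ++ split ∷ z) (++-assoc middle (split ∷ right) absorbsR)))

  length-core : length core ≡ (suc sL + mL) + suc ((i₁ + suc (suc (suc i₂))) + suc (sR + mR))
  length-core = trans (length-++ left) (cong₂ (λ a b → a + suc b) (length-replicate-++ (suc sL) mL split merge)
                  (trans (length-++ middle) (cong₂ (λ a b → a + suc b) length-middle (length-replicate-++ sR mR split merge))))

  core-dollarEnded : All DollarEnded core
  core-dollarEnded =
    ++⁺ (++⁺ (replicate⁺ (suc sL) tt) (replicate⁺ mL tt))
        (tt ∷ ++⁺ (++⁺ (replicate⁺ i₁ tt) (tt ∷ tt ∷ tt ∷ replicate⁺ i₂ tt)) (tt ∷ ++⁺ (replicate⁺ sR tt) (replicate⁺ mR tt)))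

  Cut : Set
  Cut = ∃₂ λ ms₁ ms₂ → ∃ λ ms₃ → replicate tL absorb ++ core ++ absorbsR ≡ ms₁ ++ ms₂ ++ ms₃
          × length ms₁ ≡ dbl ρ × length ms₂ ≡ N × length ms₃ ≡ dbl ρ × All DollarEnded ms₂

  cut : Cut
  cut = three-way-split absorb (dbl ρ) N tL (suc tR) core tL≤ tR< (trans (cong (λ z → tL + (z + suc tR)) length-core) total) core-dollarEnded

  cut⇒word∈ℬ : Cut → word ∈L ℬ α β
  cut⇒word∈ℬ (ms₁ , ms₂ , ms₃ , modes≡ , |ms₁| , |ms₂| , |ms₃| , ms₂-ended) =
    subst (λ R → word ∈L (rep (2 * M + N) (b0 d) · rep R (P d) · BPerp α β · rep R (P d) · rep (2 * M + N) (b0 d))) (≡.sym ρ-def)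
      (∈L-resp-≡ (≡.sym word≡)
        (cat prefix∈ (cat (dummies∈rep-P ρ ms₁ G |ms₁| (gadgets-dummyPairs ρ))
                     (cat bperp (cat (dummies∈rep-P ρ ms₃ dummy |ms₃| (dummy-dummyPairs ρ)) suffix∈)))))
    where
    c₁ c₂ c₃ : List Sym
    c₁ = unitsWord ms₁ G
    c₂ = unitsWord ms₂ realGadgets
    c₃ = unitsWord ms₃ dummy
    units≡ : unitsWord modes G ≡ c₁ ++ c₂ ++ c₃
    units≡ = begin
      unitsWord (replicate tL absorb ++ left ++ afterLeft) G
        ≡⟨ cong (λ z → unitsWord (replicate tL absorb ++ z) G) afterAbsorbs≡ ⟩
      unitsWord (replicate tL absorb ++ core ++ absorbsR) G
        ≡⟨ cong (λ z → unitsWord z G) modes≡ ⟩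
      unitsWord (ms₁ ++ ms₂ ++ ms₃) G
        ≡⟨ unitsWord-++ ms₁ (ms₂ ++ ms₃) G ⟩
      c₁ ++ unitsWord (ms₂ ++ ms₃) (λ t → G (length ms₁ + t))
        ≡⟨ cong (c₁ ++_) (unitsWord-cong (ms₂ ++ ms₃) _ realGadgets (λ t → trans (cong (λ z → G (z + t)) |ms₁|) (gadgets-shift ρ t))) ⟩
      c₁ ++ unitsWord (ms₂ ++ ms₃) realGadgets
        ≡⟨ cong (c₁ ++_) (unitsWord-++ ms₂ ms₃ realGadgets) ⟩
      c₁ ++ c₂ ++ unitsWord ms₃ (λ t → realGadgets (length ms₂ + t))
        ≡⟨ cong (λ z → c₁ ++ c₂ ++ z)
                (unitsWord-cong ms₃ _ dummy (λ t → trans (cong (λ z → realGadgets (z + t)) |ms₂|) (gadgetsFrom-dummy N β t 0))) ⟩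
      c₁ ++ c₂ ++ c₃ ∎
    word≡ : word ≡ prefix ++ c₁ ++ c₂ ++ c₃ ++ suffix
    word≡ = cong (prefix ++_) (trans (cong (_++ suffix) units≡) (trans (++-assoc c₁ _ suffix) (cong (c₁ ++_) (++-assoc c₂ c₃ suffix))))
    prefix∈ : prefix ∈L rep (2 * M + N) (b0 d)
    prefix∈ = rep-resp-≡ (trans (+-comm tL (suc pL)) prefix-count) (blocks∈b0 tL (suc pL))
    suffix∈ : suffix ∈L rep (2 * M + N) (b0 d)
    suffix∈ = rep-resp-≡ suffix-count (blocks∈b0 tR (suc pR))
    gadget∈ : ∀ j → realGadgets (toℕ j) ∈L bGadget (suc (toℕ j)) (β j)
    gadget∈ j = subst (_∈L bGadget (suc (toℕ j)) (β j)) (≡.sym (gadgetsFrom-real N β j 0)) (gadgetWord∈bGadget (suc (toℕ j)) (β j))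
    bperp : c₂ ∈L BPerp α β
    bperp = dollarEndeds∈concatR N _ ms₂ realGadgets |ms₂| ms₂-ended (λ j m e → dollarEnded∈ m e (gadget∈ j))

  word∈ℬ : word ∈L ℬ α β
  word∈ℬ = cut⇒word∈ℬ cut

-- Reading off the hypotheses

%2≡if-isOdd : ∀ m → m % 2 ≡ (if isOdd m then 1 else 0)
%2≡if-isOdd zero = refl
%2≡if-isOdd (suc zero) = refl
%2≡if-isOdd (suc (suc m)) = trans (cong (_% 2) (+-comm 2 m)) (trans ([m+n]%n≡m%n m 2) (%2≡if-isOdd m))

if-injective : ∀ a b → (if a then 1 else 0) ≡ (if b then 1 else 0) → a ≡ b
if-injective true true _ = refl
if-injective false false _ = refl

%2-≡⇒isOdd-≡ : ∀ m n → m % 2 ≡ n % 2 → isOdd m ≡ isOdd n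
%2-≡⇒isOdd-≡ m n h = if-injective (isOdd m) (isOdd n) (trans (≡.sym (%2≡if-isOdd m)) (trans h (%2≡if-isOdd n)))

odd-half : ∀ m → isOdd m ≡ true → ∃ λ q → m ≡ suc (dbl q)
odd-half (suc zero) _ = 0 , refl
odd-half (suc (suc m)) h = let q , e = odd-half m h in suc q , cong (λ z → suc (suc z)) e

even-half : ∀ m → isOdd m ≡ false → ∃ λ q → m ≡ dbl q
even-half zero _ = 0 , refl
even-half (suc (suc m)) h = let q , e = even-half m h in suc q , cong (λ z → suc (suc z)) e

dim-form : ∀ d → 3 ≤ d → d % 2 ≡ 1 → ∃ λ k → d ≡ dim k
dim-form d 3≤d h with odd-half d (%2-≡⇒isOdd-≡ d 1 h)
... | suc k , e = k , e
... | zero , refl with 3≤d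
...   | s≤s ()

*4≡dbl-dbl : ∀ q → q * 4 ≡ dbl (dbl q)
*4≡dbl-dbl q rewrite dbl≡+ (dbl q) | dbl≡+ q = identity q
  where
  identity : ∀ q → q * 4 ≡ (q + q) + (q + q)
  identity = solve-∀

countB-form : ∀ N → N % 4 ≡ 0 → 1 ≤ N → ∃ λ n → N ≡ countB n
countB-form N h 1≤N with N / 4 | trans (m≡m%n+[m/n]*n N 4) (cong (_+ (N / 4) * 4) h)
... | suc n | e = n , trans e (*4≡dbl-dbl (suc n))
... | zero | e with ≡.sym e | 1≤N
...   | refl | ()

countA-form : ∀ M t → t < M → t ≢ 0 → t ≢ M ∸ 1 → ∃₂ λ i₁ i₂ → t ≡ suc i₁ × M ≡ countA i₁ i₂
countA-form (suc M) zero _ t≢0 _ = ⊥-elim (t≢0 refl)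
countA-form (suc M) (suc i₁) (s≤s t<M) _ t≢M-1 =
  let i₂ , e = m≤n⇒∃[o]m+o≡n (≤∧≢⇒< t<M t≢M-1)
  in i₁ , i₂ , refl , cong suc (≡.sym (trans (+-suc i₁ (suc i₂)) (trans (cong suc (+-suc i₁ i₂)) e)))

countA-odd : ∀ i₁ i₂ → countA i₁ i₂ % 2 ≡ 1 → ∃ λ u → i₁ + i₂ ≡ dbl u
countA-odd i₁ i₂ h = even-half (i₁ + i₂) (not-true (begin
  not (isOdd (i₁ + i₂))                  ≡⟨ ≡.sym (isOdd-suc (i₁ + i₂)) ⟩
  isOdd (suc (suc (suc (i₁ + i₂))))       ≡⟨ cong (λ z → isOdd (suc z)) (≡.sym (trans (+-suc i₁ (suc i₂)) (cong suc (+-suc i₁ i₂)))) ⟩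
  isOdd (countA i₁ i₂)                    ≡⟨ %2-≡⇒isOdd-≡ (countA i₁ i₂) 1 h ⟩
  true                                    ∎))
  where
  not-true : ∀ {b} → not b ≡ true → b ≡ false
  not-true {false} _ = refl

vec-last : ∀ {n} (v : Vec Bool (suc n)) → ∃ λ l → toList v ≡ l ++ [ lookup v (fromℕ n) ] × length l ≡ n
vec-last {zero} (a ∷ᵥ []ᵥ) = [] , refl , refl
vec-last {suc n} (a ∷ᵥ v) = let l , e , len = vec-last v in a ∷ l , cong (a ∷_) e , cong suc len

endpoints⇒framed : ∀ k b (v : Vec Bool (dim k)) → lookup v fzero ≡ b → lookup v (fromℕ (suc (suc (dbl k)))) ≡ b →
                   ∃ (Framed k b (toList v))
endpoints⇒framed k b (a ∷ᵥ v) refl refl = let l , e , len = vec-last v in l , cong (a ∷_) e , len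

b2n≡0 : ∀ c → b2n c ≡ 0 → c ≡ false
b2n≡0 false _ = refl

dot≡0⇒Orthogonal : ∀ as bs ta tb → length as ≡ length bs →
                   sum (zipWith (λ a b → b2n (a ∧ b)) (as ++ ta) (bs ++ tb)) ≡ 0 → Orthogonal as bs
dot≡0⇒Orthogonal [] [] _ _ _ _ = []
dot≡0⇒Orthogonal (a ∷ as) (b ∷ bs) ta tb hl h =
  b2n≡0 (a ∧ b) (m+n≡0⇒m≡0 (b2n (a ∧ b)) h) ∷ dot≡0⇒Orthogonal as bs ta tb (suc-injective hl) (m+n≡0⇒n≡0 (b2n (a ∧ b)) h)

common-word : ∀ k i₁ i₂ n (α : Fin (countA i₁ i₂) → Vec Bool (dim k)) (β : Fin (countB n) → Vec Bool (dim k))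
  (i₀ : Fin (countA i₁ i₂)) (j₀ : Fin (countB n)) → toℕ i₀ ≡ suc i₁ → countA i₁ i₂ % 2 ≡ 1 →
  toℕ i₀ % 2 ≡ toℕ j₀ % 2 → dot (α i₀) (β j₀) ≡ 0 →
  (∀ i → ∃ (Framed k true (toList (α i)))) → (∀ j → ∃ (Framed k false (toList (β j)))) →
  ∃[ w ] (w ∈L 𝒜 α β × w ∈L ℬ α β)
common-word k i₁ i₂ n α β i₀ j₀ i₀≡ M-odd same-parity dot≡0 αs-framed βs-framed
  with countA-odd i₁ i₂ M-odd | m≤n⇒∃[o]m+o≡n (toℕ<n j₀) | αs-framed i₀ | βs-framed j₀
... | u , hu | jr , hjr | amid , α≡ , |amid| | bmid , β≡ , |bmid| = W.word , W.word∈𝒜 , W.word∈ℬ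
  where
  parity : isOdd (suc i₁) ≡ isOdd (toℕ j₀)
  parity = trans (cong isOdd (≡.sym i₀≡)) (%2-≡⇒isOdd-≡ (toℕ i₀) (toℕ j₀) same-parity)
  orth : Orthogonal amid bmid
  orth = dot≡0⇒Orthogonal amid bmid [ true ] [ false ] (trans |amid| (≡.sym |bmid|))
           (subst₂ (λ a b → sum (zipWith (λ p q → b2n (p ∧ q)) a b) ≡ 0) α≡ β≡ dot≡0)
  module W = Witness k i₁ i₂ n α β i₀ i₀≡ j₀ (plan i₁ i₂ n u (toℕ j₀) jr hu (trans (+-suc (toℕ j₀) jr) hjr) parity)
                     amid bmid (α≡ , |amid|) (β≡ , |bmid|) orth βs-framed

lemma4 : (M N d : ℕ) (α : Fin M → Vec Bool d) (β : Fin N → Vec Bool d) →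
    Injective _≡_ _≡_ α → Injective _≡_ _≡_ β →
    M % 2 ≡ 1 → N % 4 ≡ 0 → M < N →
    3 ≤ d → d % 2 ≡ 1 →
    (∀ i (k : Fin d) → toℕ k ≡ 0 → lookup (α i) k ≡ true) →
    (∀ i (k : Fin d) → toℕ k ≡ d ∸ 1 → lookup (α i) k ≡ true) →
    (∀ j (k : Fin d) → toℕ k ≡ 0 → lookup (β j) k ≡ false) →
    (∀ j (k : Fin d) → toℕ k ≡ d ∸ 1 → lookup (β j) k ≡ false) →
    (∀ i → ¬ Forbidden d (toList (α i))) →
    (∀ j → ¬ Forbidden d (toList (β j))) →
    (∀ (i : Fin M) j → toℕ i ≡ 0 → dot (α i) (β j) ≢ 0) →
    (∀ (i : Fin M) j → toℕ i ≡ M ∸ 1 → dot (α i) (β j) ≢ 0) →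
    ((∃[ i ] ∃[ j ] dot (α i) (β j) ≡ 0) →
      ∃[ i' ] ∃[ j' ] (dot (α i') (β j') ≡ 0 × toℕ i' % 2 ≡ toℕ j' % 2)) →
    (∃[ i ] ∃[ j ] dot (α i) (β j) ≡ 0) →
    ∃[ w ] (w ∈L 𝒜 α β × w ∈L ℬ α β)
-- Injectivity and the forbidden vectors (assumption (4)) are only needed for the converse direction.
lemma4 M N d α β _ _ M-odd N≡0 M<N 3≤d d-odd α-first α-last β-first β-last _ _ first-ok last-ok pairing orthogonal-pair
  with dim-form d 3≤d d-odd | pairing orthogonal-pair
... | k , refl | i , j , dot≡0 , same-parity
  with countA-form M (toℕ i) (toℕ<n i) (λ e → first-ok i j e dot≡0) (λ e → last-ok i j e dot≡0)
     | countB-form N N≡0 (≤-trans (s≤s z≤n) M<N)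
... | i₁ , i₂ , i≡ , refl | n , refl =
  common-word k i₁ i₂ n α β i j i≡ M-odd same-parity dot≡0
    (λ i′ → endpoints⇒framed k true (α i′) (α-first i′ fzero refl) (α-last i′ (fromℕ _) (toℕ-fromℕ _)))
    (λ j′ → endpoints⇒framed k false (β j′) (β-first j′ fzero refl) (β-last j′ (fromℕ _) (toℕ-fromℕ _)))
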